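{- For every $n\geqslant1$, the polynomial $M_n(\beta_1,\beta_4,\beta_5)=\sum_{\sigma\in\mathcal{Q}_n}\beta_1^{\mathrm{dplat}(\sigma)}\beta_4^{\mathrm{uu}(\sigma)}\beta_5^{\mathrm{ddes}(\sigma)}$ is $e$-positive; more precisely, $$M_n(\beta_1,\beta_4,\beta_5)=\sum_{i+2j+3k=2n+1}\gamma_{n,i,j,k}(\beta_1+\beta_4+\beta_5)^{i+j}.$$
   Context: A Stirling permutation of order $n$ is a word $\sigma=\sigma_1\cdots\sigma_{2n}$ on $\{1,1,\ldots,n,n\}$ such that whenever $\sigma_i=\sigma_j$, $i<j$, $\sigma_s>\sigma_i$ for all $i<s<j$; $\mathcal{Q}_n$ is the set of these; $\sigma_0=\sigma_{2n+1}=0$. $\mathrm{dplat}(\sigma)$ is the number of values $v=\sigma_i$ with $\sigma_{i-1}>\sigma_i=\sigma_{i+1}$; $\mathrm{ddes}(\sigma)$ the number of values $v=\sigma_i$ with $\sigma_{i-1}>\sigma_i>\sigma_{i+1}$; $\mathrm{uu}(\sigma)$ the number of values $v$ whose two occurrences at positions $i<j$ satisfy $\sigma_{i-1}<\sigma_i$ and $\sigma_j<\sigma_{j+1}$. The integers $\gamma_{n,i,j,k}$ are defined by $\gamma_{1,0,0,1}=1$, $\gamma_{1,i,j,k}=0$ otherwise, and for $n\geqslant2$: $\gamma_{n,i,j,k}=3(i+1)\gamma_{n-1,i+1,j,k-1}+2(j+1)\gamma_{n-1,i-1,j+1,k-1}+k\gamma_{n-1,i,j-1,k}$, with terms having a negative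 index equal to $0$; the sum is over nonnegative $i,j,k$. -}

module Defs where

open import Level using (Level)
open import Data.Nat using (ℕ; zero; suc; _+_; _*_; _<_; _≟_; _<?_)
open import Data.List using (List; []; _∷_; _++_; length; map; filter; upTo; concatMap; foldr)
open import Data.List.Relation.Unary.Any using (Any; any?)
open import Data.Product using (Σ; _×_; _,_)
open import Relation.Nullary.Decidable using (Dec; does; _×-dec_)
open import Data.Bool using (if_then_else_)
open import Relation.Binary.PropositionalEquality using (_≡_)
open import Algebra.Bundles using (CommutativeSemiring)

-- σ at 0-based position k; 0 if k is out of range.
at : List ℕ → ℕ → ℕ
at []       _       = 0
at (x ∷ _)  zero    = x
at (_ ∷ xs) (suc k) = at xs k

range1 : ℕ → List ℕ
range1 n = map suc (upTo n)

doubled : ℕ → List ℕ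
doubled n = concatMap (λ v → v ∷ v ∷ []) (range1 n)

IsStirling : ℕ → List ℕ → Set
IsStirling n σ =
  (σ ↭ doubled n) ×
  (∀ i s j → i < s → s < j → j < length σ → at σ i ≡ at σ j → at σ i < at σ s)
  where open import Data.List.Relation.Binary.Permutation.Propositional using (_↭_)

-- Statistics.  We use the padded word σ₀ σ₁ ⋯ σ₂ₙ σ₂ₙ₊₁ with σ₀ = σ₂ₙ₊₁ = 0,
-- indexed 1-based as in the paper.

padded : List ℕ → List ℕ
padded σ = 0 ∷ σ ++ (0 ∷ [])

σ[_]_ : List ℕ → ℕ → ℕ
σ[ σ ] p = at (padded σ) p

positions : ℕ → List ℕ
positions n = range1 (n + n)

DPlatAt : List ℕ → ℕ → ℕ → Set
DPlatAt σ v (suc i) = (σ[ σ ] (suc i) ≡ v) × ((σ[ σ ] (suc i) < σ[ σ ] i) × (σ[ σ ] (suc i) ≡ σ[ σ ] (suc (suc i))))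
DPlatAt σ v zero    = 0 ≡ 1

DPlatAt? : ∀ σ v p → Dec (DPlatAt σ v p)
DPlatAt? σ v (suc i) = (σ[ σ ] (suc i) ≟ v) ×-dec ((σ[ σ ] (suc i) <? σ[ σ ] i) ×-dec (σ[ σ ] (suc i) ≟ σ[ σ ] (suc (suc i))))
DPlatAt? σ v zero    = 0 ≟ 1

DDesAt : List ℕ → ℕ → ℕ → Set
DDesAt σ v (suc i) = (σ[ σ ] (suc i) ≡ v) × ((σ[ σ ] (suc i) < σ[ σ ] i) × (σ[ σ ] (suc (suc i)) < σ[ σ ] (suc i)))
DDesAt σ v zero    = 0 ≡ 1

DDesAt? : ∀ σ v p → Dec (DDesAt σ v p)
DDesAt? σ v (suc i) = (σ[ σ ] (suc i) ≟ v) ×-dec ((σ[ σ ] (suc i) <? σ[ σ ] i) ×-dec (σ[ σ ] (suc (suc i)) <? σ[ σ ] (suc i)))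
DDesAt? σ v zero    = 0 ≟ 1

UUAt : List ℕ → ℕ → ℕ → ℕ → Set
UUAt σ v (suc i) j = (suc i < j) × ((σ[ σ ] (suc i) ≡ v) × ((σ[ σ ] j ≡ v) ×
                       ((σ[ σ ] i < σ[ σ ] (suc i)) × (σ[ σ ] j < σ[ σ ] (suc j)))))
UUAt σ v zero j    = 0 ≡ 1

UUAt? : ∀ σ v p q → Dec (UUAt σ v p q)
UUAt? σ v (suc i) j = (suc i <? j) ×-dec ((σ[ σ ] (suc i) ≟ v) ×-dec ((σ[ σ ] j ≟ v) ×-dec
                       ((σ[ σ ] i <? σ[ σ ] (suc i)) ×-dec (σ[ σ ] j <? σ[ σ ] (suc j)))))
UUAt? σ v zero j    = 0 ≟ 1

dplat : ℕ → List ℕ → ℕ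
dplat n σ = length (filter (λ v → any? (DPlatAt? σ v) (positions n)) (range1 n))

ddes : ℕ → List ℕ → ℕ
ddes n σ = length (filter (λ v → any? (DDesAt? σ v) (positions n)) (range1 n))

uu : ℕ → List ℕ → ℕ
uu n σ = length (filter (λ v → any? (λ i → any? (UUAt? σ v i) (positions n)) (positions n)) (range1 n))

γ : ℕ → ℕ → ℕ → ℕ → ℕ
γ zero i j k = 0   -- not used (the paper only defines n ≥ 1)
γ (suc zero) zero zero (suc zero) = 1
γ (suc zero) _ _ _ = 0
γ (suc (suc m)) i j k = t₁ i j k + t₂ i j k + t₃ i j k
  where
  t₁ : ℕ → ℕ → ℕ → ℕ
  t₁ i j zero    = 0
  t₁ i j (suc k) = 3 * (suc i) * γ (suc m) (suc i) j k
  t₂ : ℕ → ℕ → ℕ → ℕ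
  t₂ (suc i) j (suc k) = 2 * (suc j) * γ (suc m) i (suc j) k
  t₂ _       _ _       = 0
  t₃ : ℕ → ℕ → ℕ → ℕ
  t₃ i (suc j) k = k * γ (suc m) i j k
  t₃ i zero    k = 0

-- Evaluation of the polynomials in an arbitrary commutative semiring
-- (an identity holding in every commutative semiring is exactly an
-- identity of polynomials with natural coefficients).

module Eval {c ℓ : Level} (R : CommutativeSemiring c ℓ) where
  open CommutativeSemiring R using (Carrier; rawSemiring; 0#) renaming (_+_ to _⊕_; _*_ to _⊗_)
  open import Algebra.Definitions.RawSemiring rawSemiring using (_^_) renaming (_×_ to _·_)

  ∑ : {A : Set} → List A → (A → Carrier) → Carrier
  ∑ xs f = foldr (λ x acc → f x ⊕ acc) 0# xs

  M : ℕ → List (List ℕ) → Carrier → Carrier → Carrier → Carrier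
  M n Q β₁ β₄ β₅ = ∑ Q (λ σ → (β₁ ^ dplat n σ) ⊗ ((β₄ ^ uu n σ) ⊗ (β₅ ^ ddes n σ)))

  -- Σ_{i+2j+3k = 2n+1} γ_{n,i,j,k} (β₁+β₄+β₅)^{i+j}, with i, j, k ranging over
  -- 0..2n+1 (which contains all solutions)
  RHS : ℕ → Carrier → Carrier → Carrier → Carrier
  RHS n β₁ β₄ β₅ =
    ∑ (upTo (suc (suc (n + n)))) λ i →
    ∑ (upTo (suc (suc (n + n)))) λ j →
    ∑ (upTo (suc (suc (n + n)))) λ k →
    (if does (i + 2 * j + 3 * k ≟ suc (n + n))
       then γ n i j k · ((β₁ ⊕ β₄ ⊕ β₅) ^ (i + j))
       else 0#)

{-# OPTIONS --safe #-}
-- Every Stirling permutation of order n + 1 arises exactly once by inserting the plateau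
-- (n+1)(n+1) into one of the 2n + 1 gaps of a Stirling permutation σ of order n, padded as 0σ0.
-- Give each gap to the larger of its two neighbours: a value v then owns at most one gap on
-- its left, one between its two copies and one on its right, and v is a double plateau, a
-- double descent or a uu value exactly when it has lost its left but kept its middle gap,
-- lost its middle but kept its right gap, or kept its left but lost its right gap.  An
-- insertion uses up one gap of one value and gives the new value all three, so M_n is a sum,
-- over insertion histories, of products of weights of the values that depend only on which
-- gaps each value has lost.  Summing over the orders in which a value loses t gaps gives
-- t! (β₁ + β₄ + β₅)^[t ∈ {1,2}], so only the numbers i, j, k of values with one, two and three
-- gaps left matter, and one insertion acts on them by the transpose of the recurrence of γ.

module Submission where

open import Defs
open import Level using (Level)
open import Data.Nat hiding (_^_)
import Data.Nat.Properties as ℕₚ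
open import Data.Nat.Solver using (module +-*-Solver)
open import Data.Bool using (Bool; true; false; _∧_; not; if_then_else_)
import Data.Bool.Properties as Boolₚ
open import Data.List using (List; []; _∷_; _++_; length; map; concat; concatMap; upTo; applyUpTo; filter; foldr)
import Data.List.Properties as Lₚ
open import Data.List.Membership.Propositional using (_∈_; _∉_; find; lose)
open import Data.List.Membership.Propositional.Properties
open import Data.List.Relation.Unary.All as All using (All; []; _∷_)
import Data.List.Relation.Unary.All.Properties as Allₚ
open import Data.List.Relation.Unary.Any as Any using (Any; here; there; any?)
import Data.List.Relation.Unary.Any.Properties as Anyₚ
open import Data.List.Relation.Unary.AllPairs using ([]; _∷_)
open import Data.List.Relation.Unary.Unique.Propositional using (Unique)
import Data.List.Relation.Unary.Unique.Propositional.Properties as Uₚ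
open import Data.List.Relation.Binary.Permutation.Propositional using (_↭_; prep; swap; ↭-refl; ↭-sym; ↭-trans; ↭-reflexive)
import Data.List.Relation.Binary.Permutation.Propositional as ↭
open import Data.List.Relation.Binary.Permutation.Propositional.Properties
open import Data.Product using (∃; ∃₂; _×_; _,_; proj₁; proj₂)
import Data.Product.Properties as ×ₚ
open import Data.Sum using (_⊎_; inj₁; inj₂)
open import Data.Empty using (⊥; ⊥-elim)
open import Relation.Nullary using (Dec; ¬_; yes; no; ¬?)
open import Relation.Nullary.Decidable using (does; dec-true; dec-false; does-⇔; _×-dec_)
open import Relation.Unary using (Pred; Decidable)
open import Relation.Binary using (Tri; tri<; tri≈; tri>; DecidableEquality)
open import Relation.Binary.PropositionalEquality
  using (_≡_; _≢_; refl; sym; trans; cong; cong₂; subst; subst₂; module ≡-Reasoning)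
open import Function.Base using (_∘_)
open import Function.Bundles using (_⇔_; mk⇔; Equivalence)
open import Algebra.Bundles using (CommutativeSemiring)
import Algebra.Properties.CommutativeSemigroup ℕₚ.+-commutativeSemigroup as +-CS
import Algebra.Properties.CommutativeSemigroup ℕₚ.*-commutativeSemigroup as *-CS

Unique-++-∷⁻ : ∀ {A : Set} (xs : List A) {x ys} → Unique (xs ++ x ∷ ys) → Unique (xs ++ ys) × x ∉ xs ++ ys
Unique-++-∷⁻ [] (x∉ys ∷ u) = u , λ p → All.lookup x∉ys p refl
Unique-++-∷⁻ (y ∷ xs) {x} {ys} (y∉ ∷ u) with Unique-++-∷⁻ xs u
... | u′ , x∉ = y∉′ ∷ u′ , λ { (here refl) → All.lookup y∉ (∈-++⁺ʳ xs (here refl)) refl ; (there p) → x∉ p }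
  where
  y∉′ : All (y ≢_) (xs ++ ys)
  y∉′ with Allₚ.++⁻ xs y∉
  ... | y∉xs , _ ∷ y∉ys = Allₚ.++⁺ y∉xs y∉ys

Unique-same-∈⇒↭ : ∀ {A : Set} (xs ys : List A) → Unique xs → Unique ys → (∀ z → z ∈ xs ⇔ z ∈ ys) → xs ↭ ys
Unique-same-∈⇒↭ [] [] _ _ _ = ↭-refl
Unique-same-∈⇒↭ [] (y ∷ ys) _ _ same with () ← Equivalence.from (same y) (here refl)
Unique-same-∈⇒↭ (x ∷ xs) ys (x∉xs ∷ uxs) uys same with ∈-∃++ (Equivalence.to (same x) (here refl))
... | ys₁ , ys₂ , refl with Unique-++-∷⁻ ys₁ uys
... | uys′ , x∉ = ↭-trans (prep x (Unique-same-∈⇒↭ xs (ys₁ ++ ys₂) uxs uys′ same′)) (↭-sym (shift x ys₁ ys₂))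
  where
  same′ : ∀ z → z ∈ xs ⇔ z ∈ ys₁ ++ ys₂
  same′ z = mk⇔ to from
    where
    to : z ∈ xs → z ∈ ys₁ ++ ys₂
    to p with ∈-++⁻ ys₁ (Equivalence.to (same z) (there p))
    ... | inj₁ q = ∈-++⁺ˡ q
    ... | inj₂ (here refl) = ⊥-elim (All.lookup x∉xs p refl)
    ... | inj₂ (there q) = ∈-++⁺ʳ ys₁ q
    from : z ∈ ys₁ ++ ys₂ → z ∈ xs
    from p with Equivalence.from (same z) (∈-resp-↭ (↭-sym (shift x ys₁ ys₂)) (there p))
    ... | here refl = ⊥-elim (x∉ p)
    ... | there q = q

Unique-map⁺-on : ∀ {A B : Set} (f : A → B) xs → Unique xs →
                 (∀ {x y} → x ∈ xs → y ∈ xs → f x ≡ f y → x ≡ y) → Unique (map f xs)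
Unique-map⁺-on f [] _ _ = []
Unique-map⁺-on f (x ∷ xs) (x∉ ∷ u) inj =
  Allₚ.map⁺ (All.tabulate (λ y∈ e → All.lookup x∉ y∈ (inj (here refl) (there y∈) e))) ∷
  Unique-map⁺-on f xs u (λ p q → inj (there p) (there q))

Unique-concatMap⁺ : ∀ {A B : Set} (f : A → List B) xs → Unique xs →
                    (∀ {x} → x ∈ xs → Unique (f x)) →
                    (∀ {x x′ y} → x ∈ xs → x′ ∈ xs → y ∈ f x → y ∈ f x′ → x ≡ x′) →
                    Unique (concatMap f xs)
Unique-concatMap⁺ f [] _ _ _ = []
Unique-concatMap⁺ f (x ∷ xs) (x∉ ∷ u) uf disjoint =
  Uₚ.++⁺ (uf (here refl)) (Unique-concatMap⁺ f xs u (λ p → uf (there p)) (λ p q → disjoint (there p) (there q)))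
    (λ (p , q) → in-both p q)
  where
  in-both : ∀ {y} → y ∈ f x → y ∈ concatMap f xs → ⊥
  in-both p q with find (∈-concatMap⁻ f {xs = xs} q)
  ... | x′ , x′∈ , q′ = All.lookup x∉ x′∈ (disjoint (here refl) (there x′∈) p q′)

-- Stirling permutations as iterated insertions of plateaus

insertPair : ℕ → List ℕ → ℕ → List ℕ
insertPair zero    xs       m = m ∷ m ∷ xs
insertPair (suc g) []       m = m ∷ m ∷ []
insertPair (suc g) (x ∷ xs) m = x ∷ insertPair g xs m

insertPair-↭ : ∀ g xs m → insertPair g xs m ↭ m ∷ m ∷ xs
insertPair-↭ zero    xs       m = ↭-refl
insertPair-↭ (suc g) []       m = ↭-refl
insertPair-↭ (suc g) (x ∷ xs) m =
  ↭-trans (prep x (insertPair-↭ g xs m)) (↭-trans (swap x m ↭-refl) (prep m (swap x m ↭-refl)))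

∈-insertPair⁻ : ∀ {x} g xs m → x ∈ insertPair g xs m → x ≡ m ⊎ x ∈ xs
∈-insertPair⁻ g xs m p with ∈-++⁻ (m ∷ m ∷ []) (∈-resp-↭ (insertPair-↭ g xs m) p)
... | inj₁ (here x≡m)         = inj₁ x≡m
... | inj₁ (there (here x≡m)) = inj₁ x≡m
... | inj₂ x∈xs               = inj₂ x∈xs

∉-insertPair : ∀ {v} g xs m → v ≢ m → v ∉ xs → v ∉ insertPair g xs m
∉-insertPair g xs m v≢m v∉xs p with ∈-insertPair⁻ g xs m p
... | inj₁ v≡m  = v≢m v≡m
... | inj₂ v∈xs = v∉xs v∈xs

All-insertPair : ∀ {P : ℕ → Set} g xs m → P m → All P xs → All P (insertPair g xs m)
All-insertPair zero    xs       m pm all        = pm ∷ pm ∷ all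
All-insertPair (suc g) []       m pm all        = pm ∷ pm ∷ []
All-insertPair (suc g) (x ∷ xs) m pm (px ∷ all) = px ∷ All-insertPair g xs m pm all

insertPair-view : ∀ g xs m → ∃₂ λ α β → insertPair g xs m ≡ α ++ m ∷ m ∷ β × α ++ β ≡ xs
insertPair-view zero    xs       m = [] , xs , refl , refl
insertPair-view (suc g) []       m = [] , [] , refl , refl
insertPair-view (suc g) (x ∷ xs) m with insertPair-view g xs m
... | α , β , e₁ , e₂ = x ∷ α , β , cong (x ∷_) e₁ , cong (x ∷_) e₂

insertPair-at-length : ∀ α β m → insertPair (length α) (α ++ β) m ≡ α ++ m ∷ m ∷ β
insertPair-at-length []      β m = refl
insertPair-at-length (x ∷ α) β m = cong (x ∷_) (insertPair-at-length α β m)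

insertPair-++-∷ : ∀ g xs y ys m →
  (∃ λ g′ → insertPair g (xs ++ y ∷ ys) m ≡ insertPair g′ xs m ++ y ∷ ys) ⊎
  (∃ λ g′ → insertPair g (xs ++ y ∷ ys) m ≡ xs ++ y ∷ insertPair g′ ys m)
insertPair-++-∷ zero    []       y ys m = inj₁ (0 , refl)
insertPair-++-∷ (suc g) []       y ys m = inj₂ (g , refl)
insertPair-++-∷ zero    (x ∷ xs) y ys m = inj₁ (0 , refl)
insertPair-++-∷ (suc g) (x ∷ xs) y ys m with insertPair-++-∷ g xs y ys m
... | inj₁ (g′ , e) = inj₁ (suc g′ , cong (x ∷_) e)
... | inj₂ (g′ , e) = inj₂ (g′ , cong (x ∷_) e)

insertPair-injective : ∀ {m} g σ g′ σ′ → m ∉ σ → m ∉ σ′ → g ≤ length σ → g′ ≤ length σ′ →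
                       insertPair g σ m ≡ insertPair g′ σ′ m → g ≡ g′ × σ ≡ σ′
insertPair-injective zero σ zero σ′ _ _ _ _ e = refl , Lₚ.∷-injectiveʳ (Lₚ.∷-injectiveʳ e)
insertPair-injective zero σ (suc g′) (x ∷ σ′) _ m∉σ′ _ _ e = ⊥-elim (m∉σ′ (here (Lₚ.∷-injectiveˡ e)))
insertPair-injective (suc g) (x ∷ σ) zero σ′ m∉σ _ _ _ e = ⊥-elim (m∉σ (here (sym (Lₚ.∷-injectiveˡ e))))
insertPair-injective (suc g) (x ∷ σ) (suc g′) (x′ ∷ σ′) m∉σ m∉σ′ (s≤s g≤) (s≤s g′≤) e
  with insertPair-injective g σ g′ σ′ (λ p → m∉σ (there p)) (λ p → m∉σ′ (there p)) g≤ g′≤ (Lₚ.∷-injectiveʳ e)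
     | Lₚ.∷-injectiveˡ e
... | refl , refl | refl = refl , refl

range1-suc : ∀ n → range1 (suc n) ≡ range1 n ++ suc n ∷ []
range1-suc n = begin
  map suc (upTo (suc n))     ≡⟨ cong (map suc) (sym (Lₚ.upTo-∷ʳ n)) ⟩
  map suc (upTo n ++ n ∷ []) ≡⟨ Lₚ.map-++ suc (upTo n) (n ∷ []) ⟩
  range1 n ++ suc n ∷ []     ∎
  where open ≡-Reasoning

doubled-suc : ∀ n → doubled (suc n) ≡ doubled n ++ suc n ∷ suc n ∷ []
doubled-suc n = begin
  concat (map pair (range1 (suc n)))             ≡⟨ cong (λ vs → concat (map pair vs)) (range1-suc n) ⟩
  concat (map pair (range1 n ++ suc n ∷ []))     ≡⟨ cong concat (Lₚ.map-++ pair (range1 n) (suc n ∷ [])) ⟩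
  concat (map pair (range1 n) ++ pair (suc n) ∷ []) ≡⟨ sym (Lₚ.concat-++ (map pair (range1 n)) _) ⟩
  doubled n ++ suc n ∷ suc n ∷ []                ∎
  where
  open ≡-Reasoning
  pair : ℕ → List ℕ
  pair v = v ∷ v ∷ []

doubled-suc-↭ : ∀ n → doubled (suc n) ↭ suc n ∷ suc n ∷ doubled n
doubled-suc-↭ n = ↭-trans (↭-reflexive (doubled-suc n)) (++-comm (doubled n) _)

∈-doubled⁻ : ∀ n {x} → x ∈ doubled n → 0 < x × x ≤ n
∈-doubled⁻ (suc n) p with ∈-++⁻ (doubled n) (subst (_ ∈_) (doubled-suc n) p)
... | inj₁ q                = proj₁ (∈-doubled⁻ n q) , ℕₚ.m≤n⇒m≤1+n (proj₂ (∈-doubled⁻ n q))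
... | inj₂ (here refl)        = z<s , ℕₚ.≤-refl
... | inj₂ (there (here refl)) = z<s , ℕₚ.≤-refl

length-doubled : ∀ n → length (doubled n) ≡ n + n
length-doubled zero    = refl
length-doubled (suc n) = begin
  length (doubled (suc n))          ≡⟨ ↭-length (doubled-suc-↭ n) ⟩
  suc (suc (length (doubled n)))    ≡⟨ cong (λ k → suc (suc k)) (length-doubled n) ⟩
  suc (suc (n + n))                 ≡⟨ cong suc (sym (ℕₚ.+-suc n n)) ⟩
  suc n + suc n                     ∎
  where open ≡-Reasoning

insertions : ℕ → List ℕ → List (List ℕ)
insertions n σ = map (λ g → insertPair g σ (suc n)) (upTo (suc (n + n)))

stirlings : ℕ → List (List ℕ)
stirlings zero    = [] ∷ []
stirlings (suc n) = concatMap (insertions n) (stirlings n)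

∈-insertions⁻ : ∀ n {σ τ} → τ ∈ insertions n σ → ∃ λ g → g ≤ n + n × τ ≡ insertPair g σ (suc n)
∈-insertions⁻ n p with ∈-map⁻ _ p
... | g , g∈ , τ≡ = g , ℕₚ.≤-pred (∈-upTo⁻ g∈) , τ≡

∈-stirlings⁻ : ∀ n {τ} → τ ∈ stirlings (suc n) →
               ∃₂ λ σ g → σ ∈ stirlings n × g ≤ n + n × τ ≡ insertPair g σ (suc n)
∈-stirlings⁻ n p with find (∈-concatMap⁻ (insertions n) {xs = stirlings n} p)
... | σ , σ∈ , τ∈ with ∈-insertions⁻ n τ∈
... | g , g≤ , τ≡ = σ , g , σ∈ , g≤ , τ≡

∈-stirlings⁺ : ∀ n {σ} g → σ ∈ stirlings n → g ≤ n + n → insertPair g σ (suc n) ∈ stirlings (suc n)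
∈-stirlings⁺ n g σ∈ g≤ =
  ∈-concatMap⁺ (insertions n) {xs = stirlings n}
    (Any.map (λ { refl → ∈-map⁺ (λ g → insertPair g _ (suc n)) (∈-upTo⁺ (s≤s g≤)) }) σ∈)

record Occurrences (v : ℕ) (σ : List ℕ) : Set where
  constructor mkOccurrences
  field
    before between after : List ℕ
    split     : σ ≡ before ++ v ∷ between ++ v ∷ after
    v∉before  : v ∉ before
    v<between : All (v <_) between
    v∉after   : v ∉ after

record Invariant (n : ℕ) (σ : List ℕ) : Set where
  field
    perm        : σ ↭ doubled n
    occurrences : ∀ v → 0 < v → v ≤ n → Occurrences v σ

  positive : All (0 <_) σ
  positive = All.tabulate (λ p → proj₁ (∈-doubled⁻ n (∈-resp-↭ perm p)))

  bounded : All (_≤ n) σ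
  bounded = All.tabulate (λ p → proj₂ (∈-doubled⁻ n (∈-resp-↭ perm p)))

  length≡ : length σ ≡ n + n
  length≡ = trans (↭-length perm) (length-doubled n)

  suc-∉ : suc n ∉ σ
  suc-∉ p = ℕₚ.<-irrefl refl (All.lookup bounded p)

All-<⇒∉ : ∀ {v xs} → All (v <_) xs → v ∉ xs
All-<⇒∉ v<xs p = ℕₚ.<-irrefl refl (All.lookup v<xs p)

occurrences-insertPair : ∀ {v σ} g m → v < m → Occurrences v σ → Occurrences v (insertPair g σ m)
occurrences-insertPair {v} g m v<m (mkOccurrences α β γ refl v∉α v<β v∉γ)
  with insertPair-++-∷ g α v (β ++ v ∷ γ) m
... | inj₁ (g′ , e) = mkOccurrences (insertPair g′ α m) β γ e (∉-insertPair g′ α m (ℕₚ.<⇒≢ v<m) v∉α) v<β v∉γ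
... | inj₂ (g′ , e) with insertPair-++-∷ g′ β v γ m
...   | inj₁ (g″ , e′) = mkOccurrences α (insertPair g″ β m) γ (trans e (cong (λ z → α ++ v ∷ z) e′))
                           v∉α (All-insertPair g″ β m v<m v<β) v∉γ
...   | inj₂ (g″ , e′) = mkOccurrences α β (insertPair g″ γ m) (trans e (cong (λ z → α ++ v ∷ z) e′))
                           v∉α v<β (∉-insertPair g″ γ m (ℕₚ.<⇒≢ v<m) v∉γ)

occurrences-inserted : ∀ g σ m → m ∉ σ → Occurrences m (insertPair g σ m)
occurrences-inserted g σ m m∉σ with insertPair-view g σ m
... | α , β , e , refl =
  mkOccurrences α [] β e (λ p → m∉σ (∈-++⁺ˡ p)) [] (λ p → m∉σ (∈-++⁺ʳ α p))

invariant-insertPair : ∀ {n σ} g → Invariant n σ → Invariant (suc n) (insertPair g σ (suc n))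
invariant-insertPair {n} {σ} g I = record
  { perm        = ↭-trans (insertPair-↭ g σ (suc n)) (↭-trans (prep _ (prep _ perm)) (↭-sym (doubled-suc-↭ n)))
  ; occurrences = occurrences′
  }
  where
  open Invariant I
  occurrences′ : ∀ v → 0 < v → v ≤ suc n → Occurrences v (insertPair g σ (suc n))
  occurrences′ v 0<v v≤ with ℕₚ.m≤n⇒m<n∨m≡n v≤
  ... | inj₁ (s≤s v≤n) = occurrences-insertPair g (suc n) (s≤s v≤n) (occurrences v 0<v v≤n)
  ... | inj₂ refl      = occurrences-inserted g σ (suc n) suc-∉

stirlings-invariant : ∀ n {σ} → σ ∈ stirlings n → Invariant n σ
stirlings-invariant zero (here refl) = record
  { perm = ↭-refl ; occurrences = λ v 0<v v≤0 → ⊥-elim (ℕₚ.<⇒≱ 0<v v≤0) }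
stirlings-invariant (suc n) p with ∈-stirlings⁻ n p
... | σ , g , σ∈ , _ , refl = invariant-insertPair g (stirlings-invariant n σ∈)

at-++ˡ : ∀ xs ys p → p < length xs → at (xs ++ ys) p ≡ at xs p
at-++ˡ (x ∷ xs) ys zero    _         = refl
at-++ˡ (x ∷ xs) ys (suc p) (s≤s p<) = at-++ˡ xs ys p p<

at-++ʳ : ∀ xs ys p → at (xs ++ ys) (length xs + p) ≡ at ys p
at-++ʳ []       ys p = refl
at-++ʳ (x ∷ xs) ys p = at-++ʳ xs ys p

at-∈ : ∀ xs p → p < length xs → at xs p ∈ xs
at-∈ (x ∷ xs) zero    _         = here refl
at-∈ (x ∷ xs) (suc p) (s≤s p<) = there (at-∈ xs p p<)

at-≥length : ∀ xs p → length xs ≤ p → at xs p ≡ 0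
at-≥length []       p       _         = refl
at-≥length (x ∷ xs) (suc p) (s≤s le) = at-≥length xs p le

at-≢-∉ : ∀ xs p {v} → v ≢ 0 → v ∉ xs → at xs p ≢ v
at-≢-∉ xs p v≢0 v∉xs e with p <? length xs
... | yes p< = v∉xs (subst (_∈ xs) e (at-∈ xs p p<))
... | no p≮ = v≢0 (trans (sym e) (at-≥length xs p (ℕₚ.≮⇒≥ p≮)))

<-or-offset : ∀ (a p : ℕ) → p < a ⊎ ∃ λ q → p ≡ a + q
<-or-offset zero    p       = inj₂ (p , refl)
<-or-offset (suc a) zero    = inj₁ z<s
<-or-offset (suc a) (suc p) with <-or-offset a p
... | inj₁ p<a      = inj₁ (s≤s p<a)
... | inj₂ (q , e) = inj₂ (q , cong suc e)

at≡-occurrence : ∀ {v} α β γ p → v ≢ 0 → v ∉ α → v ∉ β → v ∉ γ →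
                 at (α ++ v ∷ β ++ v ∷ γ) p ≡ v → p ≡ length α ⊎ p ≡ length α + suc (length β)
at≡-occurrence {v} α β γ p v≢0 v∉α v∉β v∉γ e with <-or-offset (length α) p
... | inj₁ p<  = ⊥-elim (at-≢-∉ α p v≢0 v∉α (trans (sym (at-++ˡ α _ p p<)) e))
... | inj₂ (zero , refl) = inj₁ (ℕₚ.+-identityʳ _)
... | inj₂ (suc q , refl) with <-or-offset (length β) q
...   | inj₁ q< = ⊥-elim (at-≢-∉ β q v≢0 v∉β
          (trans (sym (at-++ˡ β _ q q<)) (trans (sym (at-++ʳ α _ (suc q))) e)))
...   | inj₂ (zero , refl) = inj₂ (cong (λ z → length α + suc z) (ℕₚ.+-identityʳ _))
...   | inj₂ (suc r , refl) = ⊥-elim (at-≢-∉ γ r v≢0 v∉γ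
          (trans (sym (at-++ʳ β (v ∷ γ) (suc r))) (trans (sym (at-++ʳ α _ (suc (length β + suc r)))) e)))

at-between : ∀ {v} α β γ s → length α < s → s < length α + suc (length β) →
             at (α ++ v ∷ β ++ v ∷ γ) s ∈ β
at-between {v} α β γ s α< <β with <-or-offset (length α) s
... | inj₁ s<α = ⊥-elim (ℕₚ.<-asym α< s<α)
... | inj₂ (zero , refl) = ⊥-elim (ℕₚ.<-irrefl (sym (ℕₚ.+-identityʳ _)) α<)
... | inj₂ (suc q , refl) =
  subst (_∈ β) (sym (trans (at-++ʳ α _ (suc q)) (at-++ˡ β _ q q<))) (at-∈ β q q<)
  where
  q< : q < length β
  q< = ℕₚ.≤-pred (ℕₚ.+-cancelˡ-< (length α) _ _ <β)

LargerBetween : List ℕ → Set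
LargerBetween σ = ∀ i s j → i < s → s < j → j < length σ → at σ i ≡ at σ j → at σ i < at σ s

invariant⇒larger-between : ∀ {n σ} → Invariant n σ → LargerBetween σ
invariant⇒larger-between {n} {σ} I i s j i<s s<j j< σi≡σj =
  larger (occurrences v (All.lookup positive v∈σ) (All.lookup bounded v∈σ))
  where
  open Invariant I
  v : ℕ
  v = at σ i
  v∈σ : v ∈ σ
  v∈σ = at-∈ σ i (ℕₚ.<-trans i<s (ℕₚ.<-trans s<j j<))
  v≢0 : v ≢ 0
  v≢0 e = ℕₚ.<-irrefl (sym e) (All.lookup positive v∈σ)
  larger : Occurrences v σ → v < at σ s
  larger (mkOccurrences α β γ split v∉α v<β v∉γ)
    with at≡-occurrence α β γ i v≢0 v∉α (All-<⇒∉ v<β) v∉γ (subst (λ τ → at τ i ≡ v) split refl)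
       | at≡-occurrence α β γ j v≢0 v∉α (All-<⇒∉ v<β) v∉γ (subst (λ τ → at τ j ≡ v) split (sym σi≡σj))
  ... | inj₁ i≡ | inj₁ j≡ = ⊥-elim (ℕₚ.<-irrefl (trans i≡ (sym j≡)) (ℕₚ.<-trans i<s s<j))
  ... | inj₂ i≡ | inj₂ j≡ = ⊥-elim (ℕₚ.<-irrefl (trans i≡ (sym j≡)) (ℕₚ.<-trans i<s s<j))
  ... | inj₂ i≡ | inj₁ j≡ = ⊥-elim (ℕₚ.<-asym (ℕₚ.<-trans i<s s<j)
                                     (subst₂ _<_ (sym j≡) (sym i≡) (ℕₚ.m<m+n (length α) z<s)))
  ... | inj₁ i≡ | inj₂ j≡ = subst (λ τ → v < at τ s) (sym split)
                              (All.lookup v<β (at-between α β γ s (subst (_< s) i≡ i<s) (subst (s <_) j≡ s<j)))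

shiftPast : ℕ → ℕ → ℕ
shiftPast a p with p <? a
... | yes _ = p
... | no _  = 2 + p

shiftPast-< : ∀ a p → p < a → shiftPast a p ≡ p
shiftPast-< a p p<a with p <? a
... | yes _  = refl
... | no p≮a = ⊥-elim (p≮a p<a)

shiftPast-≥ : ∀ a p → a ≤ p → shiftPast a p ≡ 2 + p
shiftPast-≥ a p a≤p with p <? a
... | yes p<a = ⊥-elim (ℕₚ.<⇒≱ p<a a≤p)
... | no _    = refl

shiftPast-≤ : ∀ a p → shiftPast a p ≤ 2 + p
shiftPast-≤ a p with p <? a
... | yes _ = ℕₚ.m≤n+m p 2
... | no _  = ℕₚ.≤-refl

shiftPast-mono : ∀ a p q → p < q → shiftPast a p < shiftPast a q
shiftPast-mono a p q p<q with p <? a | q <? a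
... | yes _  | yes _   = p<q
... | yes _  | no _    = ℕₚ.<-≤-trans p<q (ℕₚ.m≤n+m q 2)
... | no p≮a | yes q<a = ⊥-elim (p≮a (ℕₚ.<-trans p<q q<a))
... | no _   | no _    = s≤s (s≤s p<q)

at-shiftPast : ∀ α γ m p → at (α ++ m ∷ m ∷ γ) (shiftPast (length α) p) ≡ at (α ++ γ) p
at-shiftPast α γ m p with <-or-offset (length α) p
... | inj₁ p< = begin
  at (α ++ m ∷ m ∷ γ) (shiftPast (length α) p) ≡⟨ cong (at (α ++ m ∷ m ∷ γ)) (shiftPast-< (length α) p p<) ⟩
  at (α ++ m ∷ m ∷ γ) p                         ≡⟨ at-++ˡ α _ p p< ⟩
  at α p                                        ≡⟨ sym (at-++ˡ α γ p p<) ⟩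
  at (α ++ γ) p                                 ∎
  where open ≡-Reasoning
... | inj₂ (q , refl) = begin
  at (α ++ m ∷ m ∷ γ) (shiftPast (length α) (length α + q))
    ≡⟨ cong (at (α ++ m ∷ m ∷ γ)) (shiftPast-≥ (length α) _ (ℕₚ.m≤m+n _ q)) ⟩
  at (α ++ m ∷ m ∷ γ) (2 + (length α + q))
    ≡⟨ cong (at (α ++ m ∷ m ∷ γ)) (sym (trans (ℕₚ.+-suc (length α) (suc q)) (cong suc (ℕₚ.+-suc (length α) q)))) ⟩
  at (α ++ m ∷ m ∷ γ) (length α + (2 + q))     ≡⟨ at-++ʳ α (m ∷ m ∷ γ) (2 + q) ⟩
  at γ q                                       ≡⟨ sym (at-++ʳ α γ q) ⟩
  at (α ++ γ) (length α + q)                   ∎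
  where open ≡-Reasoning

length-++-pair : ∀ α γ (m : ℕ) → length (α ++ m ∷ m ∷ γ) ≡ 2 + length (α ++ γ)
length-++-pair []      γ m = refl
length-++-pair (x ∷ α) γ m = cong suc (length-++-pair α γ m)

larger-between-removePair : ∀ α γ m → LargerBetween (α ++ m ∷ m ∷ γ) → LargerBetween (α ++ γ)
larger-between-removePair α γ m larger i s j i<s s<j j< e =
  subst₂ _<_ (at-shiftPast α γ m i) (at-shiftPast α γ m s)
    (larger (shiftPast a i) (shiftPast a s) (shiftPast a j) (shiftPast-mono a i s i<s) (shiftPast-mono a s j s<j)
      (ℕₚ.≤-trans (s≤s (shiftPast-≤ a j)) (subst (3 + j ≤_) (sym (length-++-pair α γ m)) (s≤s (s≤s j<))))
      (trans (at-shiftPast α γ m i) (trans e (sym (at-shiftPast α γ m j)))))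
  where
  a : ℕ
  a = length α

occurs-twice : ∀ {m : ℕ} τ ρ → τ ↭ m ∷ m ∷ ρ → ∃₂ λ α β → ∃ λ γ → τ ≡ α ++ m ∷ β ++ m ∷ γ
occurs-twice {m} τ ρ perm with ∈-∃++ (∈-resp-↭ (↭-sym perm) (here refl))
... | α , R , refl with ∈-++⁻ α (∈-resp-↭ (↭-sym (drop-∷ (↭-trans (↭-sym (shift m α R)) perm))) (here refl))
...   | inj₁ m∈α with ∈-∃++ m∈α
...     | α₁ , α₂ , refl = α₁ , α₂ , R , Lₚ.++-assoc α₁ (m ∷ α₂) (m ∷ R)
occurs-twice {m} τ ρ perm | α , R , refl | inj₂ m∈R with ∈-∃++ m∈R
...     | β , γ , refl = α , β , γ , refl

larger-between-next : ∀ {m} α b β γ → LargerBetween (α ++ m ∷ (b ∷ β) ++ m ∷ γ) → m < b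
larger-between-next {m} α b β γ larger =
  subst₂ _<_ at-first at-next (larger a (a + 1) second (ℕₚ.m<m+n a z<s) (ℕₚ.+-monoʳ-< a (s≤s (s≤s z≤n)))
    second< (trans at-first (sym at-second)))
  where
  a second : ℕ
  a = length α
  second = a + suc (suc (length β))
  L : List ℕ
  L = α ++ m ∷ (b ∷ β) ++ m ∷ γ
  at-first : at L a ≡ m
  at-first = trans (cong (at L) (sym (ℕₚ.+-identityʳ a))) (at-++ʳ α _ 0)
  at-next : at L (a + 1) ≡ b
  at-next = at-++ʳ α _ 1
  at-second : at L second ≡ m
  at-second = trans (at-++ʳ α _ (suc (suc (length β))))
                (trans (cong (at (β ++ m ∷ γ)) (sym (ℕₚ.+-identityʳ _))) (at-++ʳ β (m ∷ γ) 0))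
  second< : second < length L
  second< = subst (second <_) (sym (trans (Lₚ.length-++ α) (cong (λ z → a + suc z) (Lₚ.length-++ (b ∷ β)))))
              (ℕₚ.+-monoʳ-< a (s≤s (s≤s (ℕₚ.m<m+n (length β) z<s))))

maximum-plateau : ∀ n τ → IsStirling (suc n) τ → ∃₂ λ α γ → τ ≡ α ++ suc n ∷ suc n ∷ γ
maximum-plateau n τ (perm , larger) with occurs-twice τ (doubled n) (↭-trans perm (doubled-suc-↭ n))
... | α , []    , γ , refl = α , γ , refl
... | α , b ∷ β , γ , refl = ⊥-elim (ℕₚ.<⇒≱ (larger-between-next α b β γ larger) b≤)
  where
  b≤ : b ≤ suc n
  b≤ = proj₂ (∈-doubled⁻ (suc n) (∈-resp-↭ perm (∈-++⁺ʳ α (there (here refl)))))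

IsStirling⇒∈stirlings : ∀ n τ → IsStirling n τ → τ ∈ stirlings n
IsStirling⇒∈stirlings zero    τ (perm , _) = here (↭-empty-inv perm)
IsStirling⇒∈stirlings (suc n) τ st with maximum-plateau n τ st
... | α , γ , refl =
  subst (_∈ stirlings (suc n)) (insertPair-at-length α γ (suc n)) (∈-stirlings⁺ n (length α) σ∈ α≤)
  where
  σ-perm : α ++ γ ↭ doubled n
  σ-perm = drop-∷ (drop-∷ (↭-trans (↭-sym (insertPair-↭ (length α) (α ++ γ) (suc n)))
             (↭-trans (↭-reflexive (insertPair-at-length α γ (suc n))) (↭-trans (proj₁ st) (doubled-suc-↭ n)))))
  σ∈ : α ++ γ ∈ stirlings n
  σ∈ = IsStirling⇒∈stirlings n (α ++ γ) (σ-perm , larger-between-removePair α γ (suc n) (proj₂ st))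
  α≤ : length α ≤ n + n
  α≤ = subst (length α ≤_) (trans (↭-length σ-perm) (length-doubled n)) (Lₚ.length-++-≤ˡ α)

∈stirlings⇒IsStirling : ∀ n {σ} → σ ∈ stirlings n → IsStirling n σ
∈stirlings⇒IsStirling n {σ} p = Invariant.perm I , invariant⇒larger-between I
  where
  I : Invariant n σ
  I = stirlings-invariant n p

stirlings-unique : ∀ n → Unique (stirlings n)
stirlings-unique zero    = [] ∷ []
stirlings-unique (suc n) =
  Unique-concatMap⁺ (insertions n) (stirlings n) (stirlings-unique n) insertions-unique insertions-disjoint
  where
  m∉ : ∀ {σ} → σ ∈ stirlings n → suc n ∉ σ
  m∉ p = Invariant.suc-∉ (stirlings-invariant n p)
  ≤length : ∀ {σ g} → σ ∈ stirlings n → g ≤ n + n → g ≤ length σ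
  ≤length p g≤ = subst (_ ≤_) (sym (Invariant.length≡ (stirlings-invariant n p))) g≤
  insertions-unique : ∀ {σ} → σ ∈ stirlings n → Unique (insertions n σ)
  insertions-unique {σ} p = Unique-map⁺-on _ (upTo (suc (n + n))) (Uₚ.upTo⁺ _) λ q q′ e →
    proj₁ (insertPair-injective _ σ _ σ (m∉ p) (m∉ p)
             (≤length p (ℕₚ.≤-pred (∈-upTo⁻ q))) (≤length p (ℕₚ.≤-pred (∈-upTo⁻ q′))) e)
  insertions-disjoint : ∀ {σ σ′ τ} → σ ∈ stirlings n → σ′ ∈ stirlings n →
                        τ ∈ insertions n σ → τ ∈ insertions n σ′ → σ ≡ σ′
  insertions-disjoint {σ} {σ′} p p′ q q′ with ∈-insertions⁻ n q | ∈-insertions⁻ n q′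
  ... | g , g≤ , refl | g′ , g′≤ , e =
    proj₂ (insertPair-injective g σ g′ σ′ (m∉ p) (m∉ p′) (≤length p g≤) (≤length p′ g′≤) e)

-- Gaps and the values owning them

data Side : Set where
  left plateau right : Side

_≟ˢ_ : DecidableEquality Side
left    ≟ˢ left    = yes refl
left    ≟ˢ plateau = no λ ()
left    ≟ˢ right   = no λ ()
plateau ≟ˢ left    = no λ ()
plateau ≟ˢ plateau = yes refl
plateau ≟ˢ right   = no λ ()
right   ≟ˢ left    = no λ ()
right   ≟ˢ plateau = no λ ()
right   ≟ˢ right   = yes refl

Gap : Set
Gap = ℕ × Side

_≟ᵍ_ : DecidableEquality Gap
_≟ᵍ_ = ×ₚ.≡-dec _≟_ _≟ˢ_

open import Data.List.Membership.DecPropositional _≟ᵍ_ using (_∈?_)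

gap : ℕ → ℕ → Gap
gap x y with ℕₚ.<-cmp x y
... | tri< _ _ _ = y , left
... | tri≈ _ _ _ = x , plateau
... | tri> _ _ _ = x , right

gap-< : ∀ {x y} → x < y → gap x y ≡ (y , left)
gap-< {x} {y} x<y with ℕₚ.<-cmp x y
... | tri< _ _ _   = refl
... | tri≈ x≮y _ _ = ⊥-elim (x≮y x<y)
... | tri> x≮y _ _ = ⊥-elim (x≮y x<y)

gap-≡ : ∀ x → gap x x ≡ (x , plateau)
gap-≡ x with ℕₚ.<-cmp x x
... | tri< _ x≢x _ = ⊥-elim (x≢x refl)
... | tri≈ _ _ _   = refl
... | tri> _ x≢x _ = ⊥-elim (x≢x refl)

gap-> : ∀ {x y} → y < x → gap x y ≡ (x , right)
gap-> {x} {y} y<x with ℕₚ.<-cmp x y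
... | tri< _ _ y≮x = ⊥-elim (y≮x y<x)
... | tri≈ _ _ y≮x = ⊥-elim (y≮x y<x)
... | tri> _ _ _   = refl

gap-owner : ∀ x y → (proj₁ (gap x y) ≡ x × y ≤ x) ⊎ (proj₁ (gap x y) ≡ y × x ≤ y)
gap-owner x y with ℕₚ.<-cmp x y
... | tri< x<y _ _    = inj₂ (refl , ℕₚ.<⇒≤ x<y)
... | tri≈ _ refl _   = inj₁ (refl , ℕₚ.≤-refl)
... | tri> _ _ y<x    = inj₁ (refl , ℕₚ.<⇒≤ y<x)

gap-owner-≥ : ∀ x y → x ≤ proj₁ (gap x y)
gap-owner-≥ x y with gap-owner x y
... | inj₁ (e , _)   = subst (x ≤_) (sym e) ℕₚ.≤-refl
... | inj₂ (e , x≤y) = subst (x ≤_) (sym e) x≤y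

gap-owner-∈ : ∀ {v s} x y → gap x y ≡ (v , s) → v ≡ x ⊎ v ≡ y
gap-owner-∈ x y e with gap-owner x y
... | inj₁ (e′ , _) = inj₁ (trans (sym (cong proj₁ e)) e′)
... | inj₂ (e′ , _) = inj₂ (trans (sym (cong proj₁ e)) e′)

gapsAfter : ℕ → List ℕ → List Gap
gapsAfter p []       = gap p 0 ∷ []
gapsAfter p (x ∷ xs) = gap p x ∷ gapsAfter x xs

gaps : List ℕ → List Gap
gaps σ = gapsAfter 0 σ

freshGaps : ℕ → List Gap
freshGaps m = (m , left) ∷ (m , plateau) ∷ (m , right) ∷ []

replaceAt : ∀ {A : Set} → ℕ → List A → List A → List A
replaceAt zero    (x ∷ xs) ys = ys ++ xs
replaceAt (suc g) (x ∷ xs) ys = x ∷ replaceAt g xs ys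
replaceAt _       []       ys = []

length-gapsAfter : ∀ p xs → length (gapsAfter p xs) ≡ suc (length xs)
length-gapsAfter p []       = refl
length-gapsAfter p (x ∷ xs) = cong suc (length-gapsAfter x xs)

gapsAfter-insertPair : ∀ g σ p m → p < m → All (_< m) σ → g ≤ length σ →
                       gapsAfter p (insertPair g σ m) ≡ replaceAt g (gapsAfter p σ) (freshGaps m)
gapsAfter-insertPair zero [] p m p<m _ _ =
  cong₂ _∷_ (gap-< p<m) (cong₂ _∷_ (gap-≡ m) (cong (_∷ []) (gap-> (ℕₚ.≤-<-trans z≤n p<m))))
gapsAfter-insertPair zero (x ∷ σ) p m p<m (x<m ∷ _) _ =
  cong₂ _∷_ (gap-< p<m) (cong₂ _∷_ (gap-≡ m) (cong (_∷ gapsAfter x σ) (gap-> x<m)))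
gapsAfter-insertPair (suc g) (x ∷ σ) p m p<m (x<m ∷ σ<m) (s≤s g≤) =
  cong (gap p x ∷_) (gapsAfter-insertPair g σ x m x<m σ<m g≤)

∈-replaceAt⁻ : ∀ {A : Set} {z : A} g xs ys → z ∈ replaceAt g xs ys → z ∈ xs ⊎ z ∈ ys
∈-replaceAt⁻ zero (x ∷ xs) ys p with ∈-++⁻ ys p
... | inj₁ q = inj₂ q
... | inj₂ q = inj₁ (there q)
∈-replaceAt⁻ (suc g) (x ∷ xs) ys (here p) = inj₁ (here p)
∈-replaceAt⁻ (suc g) (x ∷ xs) ys (there p) with ∈-replaceAt⁻ g xs ys p
... | inj₁ q = inj₁ (there q)
... | inj₂ q = inj₂ q

Unique-replaceAt : ∀ {A : Set} g (xs ys : List A) → Unique xs → Unique ys →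
                   (∀ {z} → z ∈ xs → z ∈ ys → ⊥) → Unique (replaceAt g xs ys)
Unique-replaceAt zero    []       ys _ _ _ = []
Unique-replaceAt (suc g) []       ys _ _ _ = []
Unique-replaceAt zero    (x ∷ xs) ys (_ ∷ uxs) uys disjoint = Uₚ.++⁺ uys uxs (λ (p , q) → disjoint (there q) p)
Unique-replaceAt (suc g) (x ∷ xs) ys (x∉ ∷ uxs) uys disjoint =
  All.tabulate (λ p e → x≢ (∈-replaceAt⁻ g xs ys p) e) ∷ Unique-replaceAt g xs ys uxs uys (λ p q → disjoint (there p) q)
  where
  x≢ : ∀ {z} → z ∈ xs ⊎ z ∈ ys → x ≢ z
  x≢ (inj₁ q) e    = All.lookup x∉ q e
  x≢ (inj₂ q) refl = disjoint (here refl) q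

replaceAt-view : ∀ {A : Set} g (xs ys : List A) → g < length xs →
  ∃₂ λ P x → ∃ λ Q → xs ≡ P ++ x ∷ Q × length P ≡ g × replaceAt g xs ys ≡ P ++ ys ++ Q
replaceAt-view zero    (x ∷ xs) ys _ = [] , x , xs , refl , refl , refl
replaceAt-view (suc g) (x ∷ xs) ys (s≤s g<) with replaceAt-view g xs ys g<
... | P , y , Q , e₁ , e₂ , e₃ = x ∷ P , y , Q , cong (x ∷_) e₁ , cong suc e₂ , cong (x ∷_) e₃

gap-owner-≤ : ∀ {n} x y → x ≤ n → y ≤ n → proj₁ (gap x y) ≤ n
gap-owner-≤ x y x≤ y≤ with gap-owner x y
... | inj₁ (e , _) = subst (_≤ _) (sym e) x≤
... | inj₂ (e , _) = subst (_≤ _) (sym e) y≤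

gapsAfter-bounded : ∀ {n} p xs → p ≤ n → All (_≤ n) xs → All (λ ℓ → proj₁ ℓ ≤ n) (gapsAfter p xs)
gapsAfter-bounded p []       p≤ _          = gap-owner-≤ p 0 p≤ z≤n ∷ []
gapsAfter-bounded p (x ∷ xs) p≤ (x≤ ∷ xs≤) = gap-owner-≤ p x p≤ x≤ ∷ gapsAfter-bounded x xs x≤ xs≤

gapsAfter-positive : ∀ p xs → 0 < p → All (0 <_) xs → All (λ ℓ → 0 < proj₁ ℓ) (gapsAfter p xs)
gapsAfter-positive p []       0<p _            = ℕₚ.<-≤-trans 0<p (gap-owner-≥ p 0) ∷ []
gapsAfter-positive p (x ∷ xs) 0<p (0<x ∷ 0<xs) = ℕₚ.<-≤-trans 0<p (gap-owner-≥ p x) ∷ gapsAfter-positive x xs 0<x 0<xs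

gaps-positive : ∀ σ → σ ≢ [] → All (0 <_) σ → All (λ ℓ → 0 < proj₁ ℓ) (gaps σ)
gaps-positive []      σ≢[] _            = ⊥-elim (σ≢[] refl)
gaps-positive (x ∷ σ) _    (0<x ∷ 0<σ) =
  subst (λ ℓ → 0 < proj₁ ℓ) (sym (gap-< 0<x)) 0<x ∷ gapsAfter-positive x σ 0<x 0<σ

gaps-insertPair : ∀ {n σ} g → Invariant n σ → g ≤ n + n →
                  gaps (insertPair g σ (suc n)) ≡ replaceAt g (gaps σ) (freshGaps (suc n))
gaps-insertPair {n} {σ} g I g≤ =
  gapsAfter-insertPair g σ 0 (suc n) z<s (All.map s≤s (Invariant.bounded I)) (subst (g ≤_) (sym (Invariant.length≡ I)) g≤)

freshGaps-unique : ∀ m → Unique (freshGaps m)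
freshGaps-unique m = ((λ ()) ∷ (λ ()) ∷ []) ∷ ((λ ()) ∷ []) ∷ [] ∷ []

∈-freshGaps⁻ : ∀ {m ℓ} → ℓ ∈ freshGaps m → proj₁ ℓ ≡ m
∈-freshGaps⁻ (here refl)                 = refl
∈-freshGaps⁻ (there (here refl))         = refl
∈-freshGaps⁻ (there (there (here refl))) = refl

gaps-unique : ∀ n {σ} → σ ∈ stirlings n → Unique (gaps σ)
gaps-unique zero (here refl) = [] ∷ []
gaps-unique (suc n) p with ∈-stirlings⁻ n p
... | σ , g , σ∈ , g≤ , refl = subst Unique (sym (gaps-insertPair g I g≤))
  (Unique-replaceAt g (gaps σ) (freshGaps (suc n)) (gaps-unique n σ∈) (freshGaps-unique (suc n)) old≢fresh)
  where
  I : Invariant n σ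
  I = stirlings-invariant n σ∈
  old≢fresh : ∀ {ℓ} → ℓ ∈ gaps σ → ℓ ∈ freshGaps (suc n) → ⊥
  old≢fresh p q = ℕₚ.<-irrefl (∈-freshGaps⁻ q) (s≤s (All.lookup (gapsAfter-bounded 0 σ z≤n (Invariant.bounded I)) p))

Flags : Set
Flags = Bool × Bool × Bool

fresh : Flags
fresh = true , true , true

flag : Side → Flags → Bool
flag left    (l , a , r) = l
flag plateau (l , a , r) = a
flag right   (l , a , r) = r

_∈ᵇ_ : Gap → List Gap → Bool
ℓ ∈ᵇ ℓs = does (ℓ ∈? ℓs)

flags : List ℕ → ℕ → Flags
flags σ w = (w , left) ∈ᵇ gaps σ , (w , plateau) ∈ᵇ gaps σ , (w , right) ∈ᵇ gaps σ

flag-flags : ∀ σ w s → flag s (flags σ w) ≡ (w , s) ∈ᵇ gaps σ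
flag-flags σ w left    = refl
flag-flags σ w plateau = refl
flag-flags σ w right   = refl

_==ᵍ_ : Gap → Gap → Bool
ℓ ==ᵍ ℓ′ = does (ℓ ≟ᵍ ℓ′)

consume : Gap → ℕ → Flags → Flags
consume ℓ w (l , a , r) = l ∧ not ((w , left) ==ᵍ ℓ) , a ∧ not ((w , plateau) ==ᵍ ℓ) , r ∧ not ((w , right) ==ᵍ ℓ)

gapAt : List Gap → ℕ → Gap
gapAt []       _       = 0 , plateau
gapAt (ℓ ∷ ℓs) zero    = ℓ
gapAt (ℓ ∷ ℓs) (suc g) = gapAt ℓs g

gapAt-++-∷ : ∀ P ℓ Q → gapAt (P ++ ℓ ∷ Q) (length P) ≡ ℓ
gapAt-++-∷ []      ℓ Q = refl
gapAt-++-∷ (x ∷ P) ℓ Q = gapAt-++-∷ P ℓ Q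

∈ᵇ-replace : ∀ P ℓ Q ℓs z → Unique (P ++ ℓ ∷ Q) → z ∉ ℓs →
             z ∈ᵇ (P ++ ℓs ++ Q) ≡ z ∈ᵇ (P ++ ℓ ∷ Q) ∧ not (z ==ᵍ ℓ)
∈ᵇ-replace P ℓ Q ℓs z u z∉ℓs with z ≟ᵍ ℓ
... | yes refl = trans (dec-false (z ∈? (P ++ ℓs ++ Q)) z∉) (sym (Boolₚ.∧-zeroʳ _))
  where
  z∉ : z ∉ P ++ ℓs ++ Q
  z∉ p with ∈-++⁻ P p
  ... | inj₁ q = proj₂ (Unique-++-∷⁻ P u) (∈-++⁺ˡ q)
  ... | inj₂ q with ∈-++⁻ ℓs q
  ...   | inj₁ r = z∉ℓs r
  ...   | inj₂ r = proj₂ (Unique-++-∷⁻ P u) (∈-++⁺ʳ P r)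
... | no z≢ℓ = trans (does-⇔ (mk⇔ to from) (z ∈? (P ++ ℓs ++ Q)) (z ∈? (P ++ ℓ ∷ Q))) (sym (Boolₚ.∧-identityʳ _))
  where
  to : z ∈ P ++ ℓs ++ Q → z ∈ P ++ ℓ ∷ Q
  to p with ∈-++⁻ P p
  ... | inj₁ q = ∈-++⁺ˡ q
  ... | inj₂ q with ∈-++⁻ ℓs q
  ...   | inj₁ r = ⊥-elim (z∉ℓs r)
  ...   | inj₂ r = ∈-++⁺ʳ P (there r)
  from : z ∈ P ++ ℓ ∷ Q → z ∈ P ++ ℓs ++ Q
  from p with ∈-++⁻ P p
  ... | inj₁ q         = ∈-++⁺ˡ q
  ... | inj₂ (here e)  = ⊥-elim (z≢ℓ e)
  ... | inj₂ (there r) = ∈-++⁺ʳ P (∈-++⁺ʳ ℓs r)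

length-gaps : ∀ {n σ} → Invariant n σ → length (gaps σ) ≡ suc (n + n)
length-gaps {σ = σ} I = trans (length-gapsAfter 0 σ) (cong suc (Invariant.length≡ I))

gaps-insertPair-view : ∀ {n σ} → Invariant n σ → ∀ g → g ≤ n + n →
  ∃₂ λ P Q → gaps σ ≡ P ++ gapAt (gaps σ) g ∷ Q × gaps (insertPair g σ (suc n)) ≡ P ++ freshGaps (suc n) ++ Q
gaps-insertPair-view {n} {σ} I g g≤
  with replaceAt-view g (gaps σ) (freshGaps (suc n)) (subst (g <_) (sym (length-gaps I)) (s≤s g≤))
... | P , ℓ , Q , gaps≡ , refl , replaced =
  P , Q , trans gaps≡ (cong (λ ℓ′ → P ++ ℓ′ ∷ Q) (sym gapAt≡)) , trans (gaps-insertPair (length P) I g≤) replaced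
  where
  gapAt≡ : gapAt (gaps σ) (length P) ≡ ℓ
  gapAt≡ = trans (cong (λ ℓs → gapAt ℓs (length P)) gaps≡) (gapAt-++-∷ P ℓ Q)

flags-insertPair : ∀ {n σ} → σ ∈ stirlings n → ∀ g → g ≤ n + n → ∀ w → w ≢ suc n →
                   flags (insertPair g σ (suc n)) w ≡ consume (gapAt (gaps σ) g) w (flags σ w)
flags-insertPair {n} {σ} σ∈ g g≤ w w≢m with gaps-insertPair-view (stirlings-invariant n σ∈) g g≤
... | P , Q , gaps≡ , inserted≡ = cong₂ _,_ (∈ᵇ-inserted left) (cong₂ _,_ (∈ᵇ-inserted plateau) (∈ᵇ-inserted right))
  where
  ℓ : Gap
  ℓ = gapAt (gaps σ) g
  ∈ᵇ-inserted : ∀ s → (w , s) ∈ᵇ gaps (insertPair g σ (suc n)) ≡ (w , s) ∈ᵇ gaps σ ∧ not ((w , s) ==ᵍ ℓ)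
  ∈ᵇ-inserted s = begin
    (w , s) ∈ᵇ gaps (insertPair g σ (suc n))       ≡⟨ cong ((w , s) ∈ᵇ_) inserted≡ ⟩
    (w , s) ∈ᵇ (P ++ freshGaps (suc n) ++ Q)      ≡⟨ ∈ᵇ-replace P ℓ Q (freshGaps (suc n)) (w , s)
                                                       (subst Unique gaps≡ (gaps-unique n σ∈)) (λ p → w≢m (∈-freshGaps⁻ p)) ⟩
    (w , s) ∈ᵇ (P ++ ℓ ∷ Q) ∧ not ((w , s) ==ᵍ ℓ)  ≡⟨ cong (λ ℓs → (w , s) ∈ᵇ ℓs ∧ not ((w , s) ==ᵍ ℓ)) (sym gaps≡) ⟩
    (w , s) ∈ᵇ gaps σ ∧ not ((w , s) ==ᵍ ℓ)        ∎
    where open ≡-Reasoning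

flags-inserted : ∀ {n σ} → σ ∈ stirlings n → ∀ g → g ≤ n + n → flags (insertPair g σ (suc n)) (suc n) ≡ fresh
flags-inserted {n} {σ} σ∈ g g≤ with gaps-insertPair-view (stirlings-invariant n σ∈) g g≤
... | P , Q , _ , inserted≡ =
  cong₂ _,_ (present (here refl)) (cong₂ _,_ (present (there (here refl))) (present (there (there (here refl)))))
  where
  present : ∀ {s} → (suc n , s) ∈ freshGaps (suc n) → (suc n , s) ∈ᵇ gaps (insertPair g σ (suc n)) ≡ true
  present p = dec-true ((suc n , _) ∈? _) (subst ((suc n , _) ∈_) (sym inserted≡) (∈-++⁺ʳ P (∈-++⁺ˡ p)))

ownGaps : ℕ → Flags → List Gap
ownGaps v (l , a , r) =
  (if l then (v , left) ∷ [] else []) ++ (if a then (v , plateau) ∷ [] else []) ++ (if r then (v , right) ∷ [] else [])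

∈-ownGaps⁻ : ∀ {ℓ} v fs → ℓ ∈ ownGaps v fs → ∃ λ s → ℓ ≡ (v , s) × flag s fs ≡ true
∈-ownGaps⁻ v (true  , a     , r)    (here refl)                 = left , refl , refl
∈-ownGaps⁻ v (true  , true  , r)    (there (here refl))         = plateau , refl , refl
∈-ownGaps⁻ v (true  , true  , true) (there (there (here refl))) = right , refl , refl
∈-ownGaps⁻ v (true  , false , true) (there (here refl))         = right , refl , refl
∈-ownGaps⁻ v (false , true  , r)    (here refl)                 = plateau , refl , refl
∈-ownGaps⁻ v (false , true  , true) (there (here refl))         = right , refl , refl
∈-ownGaps⁻ v (false , false , true) (here refl)                 = right , refl , refl

∈-ownGaps⁺ : ∀ v fs s → flag s fs ≡ true → (v , s) ∈ ownGaps v fs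
∈-ownGaps⁺ v (true  , a     , r)    left    refl = here refl
∈-ownGaps⁺ v (true  , true  , r)    plateau refl = there (here refl)
∈-ownGaps⁺ v (false , true  , r)    plateau refl = here refl
∈-ownGaps⁺ v (true  , true  , true) right   refl = there (there (here refl))
∈-ownGaps⁺ v (true  , false , true) right   refl = there (here refl)
∈-ownGaps⁺ v (false , true  , true) right   refl = there (here refl)
∈-ownGaps⁺ v (false , false , true) right   refl = here refl

ownGaps-unique : ∀ v fs → Unique (ownGaps v fs)
ownGaps-unique v (true  , true  , true)  = ((λ ()) ∷ (λ ()) ∷ []) ∷ ((λ ()) ∷ []) ∷ [] ∷ []
ownGaps-unique v (true  , true  , false) = ((λ ()) ∷ []) ∷ [] ∷ []
ownGaps-unique v (true  , false , true)  = ((λ ()) ∷ []) ∷ [] ∷ []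
ownGaps-unique v (true  , false , false) = [] ∷ []
ownGaps-unique v (false , true  , true)  = ((λ ()) ∷ []) ∷ [] ∷ []
ownGaps-unique v (false , true  , false) = [] ∷ []
ownGaps-unique v (false , false , true)  = [] ∷ []
ownGaps-unique v (false , false , false) = []

range1-unique : ∀ n → Unique (range1 n)
range1-unique n = Uₚ.map⁺ ℕₚ.suc-injective (Uₚ.upTo⁺ n)

∈-range1⁺ : ∀ {n w} → 0 < w → w ≤ n → w ∈ range1 n
∈-range1⁺ {w = suc w} _ w≤n = ∈-map⁺ suc (∈-upTo⁺ w≤n)

∈-range1⁻ : ∀ {n w} → w ∈ range1 n → 0 < w × w ≤ n
∈-range1⁻ p with ∈-map⁻ suc p
... | _ , q , refl = z<s , ∈-upTo⁻ q

allOwnGaps : List ℕ → ℕ → List Gap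
allOwnGaps σ n = concatMap (λ v → ownGaps v (flags σ v)) (range1 n)

gaps-↭-allOwnGaps : ∀ n {σ} → σ ∈ stirlings (suc n) → gaps σ ↭ allOwnGaps σ (suc n)
gaps-↭-allOwnGaps n {σ} σ∈ = Unique-same-∈⇒↭ (gaps σ) (allOwnGaps σ (suc n)) (gaps-unique (suc n) σ∈) unique same
  where
  I : Invariant (suc n) σ
  I = stirlings-invariant (suc n) σ∈
  σ≢[] : σ ≢ []
  σ≢[] σ≡[] with () ← trans (sym (cong length σ≡[])) (Invariant.length≡ I)
  unique : Unique (allOwnGaps σ (suc n))
  unique = Unique-concatMap⁺ _ (range1 (suc n)) (range1-unique (suc n)) (λ {v} _ → ownGaps-unique v (flags σ v))
    λ {v} {v′} _ _ p q → trans (sym (cong proj₁ (proj₁ (proj₂ (∈-ownGaps⁻ v (flags σ v) p)))))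
                                (cong proj₁ (proj₁ (proj₂ (∈-ownGaps⁻ v′ (flags σ v′) q))))
  same : ∀ ℓ → ℓ ∈ gaps σ ⇔ ℓ ∈ allOwnGaps σ (suc n)
  same (w , s) = mk⇔ to from
    where
    to : (w , s) ∈ gaps σ → (w , s) ∈ allOwnGaps σ (suc n)
    to p = ∈-concatMap⁺ (λ v → ownGaps v (flags σ v)) {xs = range1 (suc n)}
             (Any.map (λ { refl → ∈-ownGaps⁺ w (flags σ w) s (trans (flag-flags σ w s) (dec-true ((w , s) ∈? gaps σ) p)) })
               (∈-range1⁺ (All.lookup (gaps-positive σ σ≢[] (Invariant.positive I)) p)
                          (All.lookup (gapsAfter-bounded 0 σ z≤n (Invariant.bounded I)) p)))
    from : (w , s) ∈ allOwnGaps σ (suc n) → (w , s) ∈ gaps σ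
    from p with find (∈-concatMap⁻ (λ v → ownGaps v (flags σ v)) {xs = range1 (suc n)} p)
    ... | v , _ , q with ∈-ownGaps⁻ v (flags σ v) q
    ... | s′ , refl , set with (v , s′) ∈? gaps σ | flag-flags σ v s′
    ...   | yes r | _ = r
    ...   | no _  | e with () ← trans (sym set) e

-- The three statistics in terms of owned gaps

lastOf : ℕ → List ℕ → ℕ
lastOf p []       = p
lastOf p (x ∷ xs) = lastOf x xs

lastOf-∈ : ∀ p xs → lastOf p xs ∈ p ∷ xs
lastOf-∈ p []       = here refl
lastOf-∈ p (x ∷ xs) = there (lastOf-∈ x xs)

at-lastOf : ∀ p xs ys → at (p ∷ xs ++ ys) (length xs) ≡ lastOf p xs
at-lastOf p []       ys = refl
at-lastOf p (x ∷ xs) ys = at-lastOf x xs ys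

headOr : ℕ → List ℕ → ℕ
headOr d []      = d
headOr d (x ∷ _) = x

headOr-≢ : ∀ {v} xs → v ≢ 0 → v ∉ xs → headOr 0 xs ≢ v
headOr-≢ []      v≢0 _    e = v≢0 (sym e)
headOr-≢ (x ∷ _) _   v∉xs e = v∉xs (here (sym e))

at-++-0 : ∀ xs → at (xs ++ 0 ∷ []) 0 ≡ headOr 0 xs
at-++-0 []      = refl
at-++-0 (x ∷ _) = refl

gapsBetween : ℕ → List ℕ → ℕ → List Gap
gapsBetween p []       y = gap p y ∷ []
gapsBetween p (x ∷ xs) y = gap p x ∷ gapsBetween x xs y

gapsAfter-++ : ∀ p xs y ys → gapsAfter p (xs ++ y ∷ ys) ≡ gapsBetween p xs y ++ gapsAfter y ys
gapsAfter-++ p []       y ys = refl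
gapsAfter-++ p (x ∷ xs) y ys = cong (gap p x ∷_) (gapsAfter-++ x xs y ys)

gap-lastOf-∈ : ∀ p xs y → gap (lastOf p xs) y ∈ gapsBetween p xs y
gap-lastOf-∈ p []       y = here refl
gap-lastOf-∈ p (x ∷ xs) y = there (gap-lastOf-∈ x xs y)

gap-headOr-∈ : ∀ v xs → gap v (headOr 0 xs) ∈ gapsAfter v xs
gap-headOr-∈ v []      = here refl
gap-headOr-∈ v (x ∷ _) = here refl

gapsBetween-foreign : ∀ {v s} p xs y → v ∉ p ∷ xs → (v , s) ∈ gapsBetween p xs y → (v , s) ≡ gap (lastOf p xs) y
gapsBetween-foreign p []       y v∉ (here e) = e
gapsBetween-foreign p (x ∷ xs) y v∉ (here e) with gap-owner-∈ p x (sym e)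
... | inj₁ refl = ⊥-elim (v∉ (here refl))
... | inj₂ refl = ⊥-elim (v∉ (there (here refl)))
gapsBetween-foreign p (x ∷ xs) y v∉ (there q) = gapsBetween-foreign x xs y (λ r → v∉ (there r)) q

gapsBetween-larger : ∀ {v s} p xs → All (v <_) (p ∷ xs) → (v , s) ∉ gapsBetween p xs v
gapsBetween-larger p [] (v<p ∷ []) (here e) = ℕₚ.<-irrefl (cong proj₁ (trans e (gap-> v<p))) v<p
gapsBetween-larger p (x ∷ xs) (v<p ∷ v<xs) (here e) with gap-owner-∈ p x (sym e)
... | inj₁ refl = ℕₚ.<-irrefl refl v<p
... | inj₂ refl = ℕₚ.<-irrefl refl (All.head v<xs)
gapsBetween-larger p (x ∷ xs) (v<p ∷ v<xs) (there q) = gapsBetween-larger x xs v<xs q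

gapsAfter-foreign : ∀ {v s} p xs → v ≢ 0 → v ∉ p ∷ xs → (v , s) ∉ gapsAfter p xs
gapsAfter-foreign p [] v≢0 v∉ (here e) with gap-owner-∈ p 0 (sym e)
... | inj₁ refl = v∉ (here refl)
... | inj₂ refl = v≢0 refl
gapsAfter-foreign p (x ∷ xs) v≢0 v∉ (here e) with gap-owner-∈ p x (sym e)
... | inj₁ refl = v∉ (here refl)
... | inj₂ refl = v∉ (there (here refl))
gapsAfter-foreign p (x ∷ xs) v≢0 v∉ (there q) = gapsAfter-foreign x xs v≢0 (λ r → v∉ (there r)) q

gapsBetween-own : ∀ {v s} xs → All (v <_) xs → (v , s) ∈ gapsBetween v xs v → s ≡ plateau × xs ≡ []
gapsBetween-own {v} []       _           (here e) = cong proj₂ (trans e (gap-≡ v)) , refl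
gapsBetween-own     (x ∷ xs) (v<x ∷ _)   (here e) = ⊥-elim (ℕₚ.<-irrefl (cong proj₁ (trans e (gap-< v<x))) v<x)
gapsBetween-own     (x ∷ xs) (v<x ∷ v<xs) (there q) = ⊥-elim (gapsBetween-larger x xs (v<x ∷ v<xs) q)

gapsAfter-own : ∀ {v s} xs → v ≢ 0 → v ∉ xs → (v , s) ∈ gapsAfter v xs → (v , s) ≡ gap v (headOr 0 xs)
gapsAfter-own []       _   _    (here e)  = e
gapsAfter-own (x ∷ xs) _   _    (here e)  = e
gapsAfter-own (x ∷ xs) v≢0 v∉xs (there q) = ⊥-elim (gapsAfter-foreign x xs v≢0 v∉xs q)

gap-left⁻ : ∀ {v s x} → x ≢ v → (v , s) ≡ gap x v → s ≡ left × x < v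
gap-left⁻ {v} {s} {x} x≢v e = by-cases (ℕₚ.<-cmp x v)
  where
  by-cases : Tri (x < v) (x ≡ v) (v < x) → s ≡ left × x < v
  by-cases (tri< x<v _ _) = cong proj₂ (trans e (gap-< x<v)) , x<v
  by-cases (tri≈ _ x≡v _) = ⊥-elim (x≢v x≡v)
  by-cases (tri> _ _ v<x) = ⊥-elim (x≢v (sym (cong proj₁ (trans e (gap-> v<x)))))

gap-right⁻ : ∀ {v s x} → x ≢ v → (v , s) ≡ gap v x → s ≡ right × x < v
gap-right⁻ {v} {s} {x} x≢v e = by-cases (ℕₚ.<-cmp v x)
  where
  by-cases : Tri (v < x) (v ≡ x) (x < v) → s ≡ right × x < v
  by-cases (tri< v<x _ _) = ⊥-elim (x≢v (sym (cong proj₁ (trans e (gap-< v<x)))))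
  by-cases (tri≈ _ v≡x _) = ⊥-elim (x≢v (sym v≡x))
  by-cases (tri> _ _ x<v) = cong proj₂ (trans e (gap-> x<v)) , x<v

Any-positions⁻ : ∀ n {P : ℕ → Set} → Any P (positions n) → ∃ λ q → q < n + n × P (suc q)
Any-positions⁻ n p with find (Anyₚ.map⁻ {xs = upTo (n + n)} p)
... | q , q∈ , pq = q , ∈-upTo⁻ q∈ , pq

Any-positions⁺ : ∀ n {P : ℕ → Set} q → q < n + n → P (suc q) → Any P (positions n)
Any-positions⁺ n q q< pq = lose (∈-map⁺ suc (∈-upTo⁺ q<)) pq

≡[]? : (xs : List ℕ) → Dec (xs ≡ [])
≡[]? []      = yes refl
≡[]? (_ ∷ _) = no λ ()

does-<-flip : ∀ x y → x ≢ y → does (y <? x) ≡ not (does (x <? y))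
does-<-flip x y x≢y with ℕₚ.<-cmp x y
... | tri< x<y _ y≮x = trans (dec-false (y <? x) y≮x) (cong not (sym (dec-true (x <? y) x<y)))
... | tri≈ _ x≡y _   = ⊥-elim (x≢y x≡y)
... | tri> x≮y _ y<x = trans (dec-true (y <? x) y<x) (cong not (sym (dec-false (x <? y) x≮y)))

+-suc-length⇒[] : ∀ m (xs : List ℕ) → suc m ≡ m + suc (length xs) → xs ≡ []
+-suc-length⇒[] m []       _ = refl
+-suc-length⇒[] m (x ∷ xs) e = ⊥-elim (ℕₚ.m+1+n≢m m (sym (ℕₚ.suc-injective (trans e (ℕₚ.+-suc m _)))))

≤-headOr : ∀ {v} xs → All (v <_) xs → v ≤ headOr v xs
≤-headOr []      _         = ℕₚ.≤-refl
≤-headOr (_ ∷ _) (v<x ∷ _) = ℕₚ.<⇒≤ v<x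

≢[]⇒∷ : ∀ (xs : List ℕ) → xs ≢ [] → ∃₂ λ y ys → xs ≡ y ∷ ys
≢[]⇒∷ []       xs≢[] = ⊥-elim (xs≢[] refl)
≢[]⇒∷ (y ∷ ys) _     = y , ys , refl

module ValueStatistics {n σ v} (I : Invariant n σ) (0<v : 0 < v) (v≤n : v ≤ n) where
  open Occurrences (Invariant.occurrences I v 0<v v≤n)

  v≢0 : v ≢ 0
  v≢0 e = ℕₚ.<-irrefl (sym e) 0<v

  α₀ γ₀ ρ : List ℕ
  α₀ = 0 ∷ before
  γ₀ = after ++ 0 ∷ []
  ρ  = α₀ ++ v ∷ between ++ v ∷ γ₀

  σ[]≡at : ∀ p → σ[ σ ] p ≡ at ρ p
  σ[]≡at p = cong (λ τ → at (0 ∷ τ) p) (begin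
    σ ++ 0 ∷ []                                      ≡⟨ cong (_++ 0 ∷ []) split ⟩
    (before ++ v ∷ between ++ v ∷ after) ++ 0 ∷ []   ≡⟨ Lₚ.++-assoc before (v ∷ between ++ v ∷ after) (0 ∷ []) ⟩
    before ++ v ∷ (between ++ v ∷ after) ++ 0 ∷ []   ≡⟨ cong (λ τ → before ++ v ∷ τ) (Lₚ.++-assoc between (v ∷ after) (0 ∷ [])) ⟩
    before ++ v ∷ between ++ v ∷ γ₀                  ∎)
    where open ≡-Reasoning

  v∉α₀ : v ∉ α₀
  v∉α₀ (here e)  = v≢0 e
  v∉α₀ (there p) = v∉before p

  v∉γ₀ : v ∉ γ₀
  v∉γ₀ p with ∈-++⁻ after p
  ... | inj₁ q        = v∉after q
  ... | inj₂ (here e) = v≢0 e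

  first second : ℕ
  first  = suc (length before)
  second = first + suc (length between)

  σ[]≡v⇒ : ∀ p → σ[ σ ] p ≡ v → p ≡ first ⊎ p ≡ second
  σ[]≡v⇒ p e = at≡-occurrence α₀ between γ₀ p v≢0 v∉α₀ (All-<⇒∉ v<between) v∉γ₀ (trans (sym (σ[]≡at p)) e)

  σ-first : σ[ σ ] first ≡ v
  σ-first = trans (σ[]≡at first) (trans (cong (at ρ) (sym (ℕₚ.+-identityʳ first))) (at-++ʳ α₀ _ 0))

  σ-second : σ[ σ ] second ≡ v
  σ-second = trans (σ[]≡at second) (trans (at-++ʳ α₀ _ (suc (length between)))
               (trans (cong (at (between ++ v ∷ γ₀)) (sym (ℕₚ.+-identityʳ _))) (at-++ʳ between (v ∷ γ₀) 0)))

  σ-after-first : σ[ σ ] (suc first) ≡ headOr v between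
  σ-after-first = trans (σ[]≡at (suc first))
    (trans (cong (at ρ) (sym (ℕₚ.+-comm first 1))) (trans (at-++ʳ α₀ _ 1) (at-head between)))
    where
    at-head : ∀ xs → at (xs ++ v ∷ γ₀) 0 ≡ headOr v xs
    at-head []      = refl
    at-head (_ ∷ _) = refl

  σ-before-second-∈ : ∀ b β → between ≡ b ∷ β → σ[ σ ] (first + length between) ∈ between
  σ-before-second-∈ b β e = subst (_∈ between) (sym at-last) (at-∈ between (length β) β<)
    where
    β< : length β < length between
    β< = subst (length β <_) (sym (cong length e)) ℕₚ.≤-refl
    at-last : σ[ σ ] (first + length between) ≡ at between (length β)
    at-last = trans (σ[]≡at (first + length between)) (trans (cong (λ xs → at ρ (first + length xs)) e)
                (trans (at-++ʳ α₀ _ (suc (length β))) (at-++ˡ between (v ∷ γ₀) (length β) β<)))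

  pre post : ℕ
  pre  = lastOf 0 before
  post = headOr 0 after

  σ-pre : σ[ σ ] (length before) ≡ pre
  σ-pre = trans (σ[]≡at (length before)) (at-lastOf 0 before _)

  σ-post : σ[ σ ] (suc second) ≡ post
  σ-post = trans (σ[]≡at (suc second))
    (trans (cong (at ρ) (sym (ℕₚ.+-suc first (suc (length between)))))
    (trans (at-++ʳ α₀ _ (suc (suc (length between))))
    (trans (cong (at (between ++ v ∷ γ₀)) (ℕₚ.+-comm 1 (length between)))
    (trans (at-++ʳ between (v ∷ γ₀) 1) (at-++-0 after)))))

  pre≢v : pre ≢ v
  pre≢v e = v∉α₀ (subst (_∈ α₀) e (lastOf-∈ 0 before))

  post≢v : post ≢ v
  post≢v = headOr-≢ after v≢0 v∉after

  gaps≡ : gaps σ ≡ gapsBetween 0 before v ++ gapsBetween v between v ++ gapsAfter v after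
  gaps≡ = trans (cong (gapsAfter 0) split)
            (trans (gapsAfter-++ 0 before v (between ++ v ∷ after))
                   (cong (gapsBetween 0 before v ++_) (gapsAfter-++ v between v after)))

  Present : Side → Set
  Present left    = pre < v
  Present plateau = between ≡ []
  Present right   = post < v

  gap-present⁻ : ∀ s → (v , s) ∈ gaps σ → Present s
  gap-present⁻ s p with ∈-++⁻ (gapsBetween 0 before v) (subst ((v , s) ∈_) gaps≡ p)
  ... | inj₁ q with gap-left⁻ pre≢v (gapsBetween-foreign 0 before v v∉α₀ q)
  ...   | refl , pre<v = pre<v
  gap-present⁻ s p | inj₂ q with ∈-++⁻ (gapsBetween v between v) q
  ...   | inj₁ r with gapsBetween-own between v<between r
  ...     | refl , between≡[] = between≡[]
  gap-present⁻ s p | inj₂ q | inj₂ r with gap-right⁻ post≢v (gapsAfter-own after v≢0 v∉after r)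
  ...     | refl , post<v = post<v

  gap-present⁺ : ∀ s → Present s → (v , s) ∈ gaps σ
  gap-present⁺ left pre<v = subst ((v , left) ∈_) (sym gaps≡)
    (∈-++⁺ˡ (subst (_∈ gapsBetween 0 before v) (gap-< pre<v) (gap-lastOf-∈ 0 before v)))
  gap-present⁺ plateau between≡[] = subst ((v , plateau) ∈_) (sym gaps≡) (∈-++⁺ʳ (gapsBetween 0 before v)
    (∈-++⁺ˡ (subst (λ xs → (v , plateau) ∈ gapsBetween v xs v) (sym between≡[]) (here (sym (gap-≡ v))))))
  gap-present⁺ right post<v = subst ((v , right) ∈_) (sym gaps≡) (∈-++⁺ʳ (gapsBetween 0 before v)
    (∈-++⁺ʳ (gapsBetween v between v) (subst (_∈ gapsAfter v after) (gap-> post<v) (gap-headOr-∈ v after))))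

  length-σ : n + n ≡ length before + suc (length between + suc (length after))
  length-σ = trans (sym (Invariant.length≡ I)) (trans (cong length split)
               (trans (Lₚ.length-++ before) (cong (λ k → length before + suc k) (Lₚ.length-++ between))))

  before< : length before < n + n
  before< = subst (length before <_) (sym length-σ) (ℕₚ.m<m+n (length before) z<s)

  second-1< : length before + suc (length between) < n + n
  second-1< = subst (length before + suc (length between) <_) (sym length-σ)
                (ℕₚ.+-monoʳ-< (length before) (s≤s (ℕₚ.m<m+n (length between) z<s)))

  dplat⇒ : Any (DPlatAt σ v) (positions n) → v < pre × between ≡ []
  dplat⇒ p with Any-positions⁻ n p
  ... | q , _ , (σq≡v , σq<σq-1 , σq≡σq+1) with σ[]≡v⇒ (suc q) σq≡v
  ...   | inj₂ q≡second = ⊥-elim (post≢v (trans (sym σ-post)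
                            (trans (cong (λ k → σ[ σ ] (suc k)) (sym q≡second)) (trans (sym σq≡σq+1) σq≡v))))
  ...   | inj₁ refl = subst₂ _<_ σq≡v σ-pre σq<σq-1 , adjacent (σ[]≡v⇒ (suc first) (trans (sym σq≡σq+1) σq≡v))
    where
    adjacent : suc first ≡ first ⊎ suc first ≡ second → between ≡ []
    adjacent (inj₁ e) = ⊥-elim (ℕₚ.<-irrefl (sym e) ℕₚ.≤-refl)
    adjacent (inj₂ e) = +-suc-length⇒[] first between e

  dplat⇐ : v < pre → between ≡ [] → Any (DPlatAt σ v) (positions n)
  dplat⇐ v<pre between≡[] = Any-positions⁺ n (length before) before<
    ( σ-first
    , subst₂ _<_ (sym σ-first) (sym σ-pre) v<pre
    , trans σ-first (sym (trans σ-after-first (cong (headOr v) between≡[]))))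

  ddes⇒ : Any (DDesAt σ v) (positions n) → between ≢ [] × post < v
  ddes⇒ p with Any-positions⁻ n p
  ... | q , _ , (σq≡v , σq<σq-1 , σq+1<σq) with σ[]≡v⇒ (suc q) σq≡v
  ...   | inj₁ refl = ⊥-elim (ℕₚ.<⇒≱ (subst₂ _<_ σ-after-first σq≡v σq+1<σq) (≤-headOr between v<between))
  ...   | inj₂ q≡second = between≢[] , subst₂ _<_ (trans (cong (λ k → σ[ σ ] (suc k)) q≡second) σ-post) σq≡v σq+1<σq
    where
    between≢[] : between ≢ []
    between≢[] e = ℕₚ.<-irrefl refl (subst₂ _<_ σq≡v (trans (cong (σ[ σ ]_) q≡first) σ-first) σq<σq-1)
      where
      q≡first : q ≡ first
      q≡first = ℕₚ.suc-injective (trans q≡second (trans (cong (λ xs → first + suc (length xs)) e) (ℕₚ.+-comm first 1)))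

  ddes⇐ : between ≢ [] → post < v → Any (DDesAt σ v) (positions n)
  ddes⇐ between≢[] post<v with ≢[]⇒∷ between between≢[]
  ... | b , β , e = Any-positions⁺ n (first + length between) q<
      ( σ-second′
      , subst₂ _<_ (sym σ-second′) refl (All.lookup v<between (σ-before-second-∈ b β e))
      , subst₂ _<_ (sym (trans (cong (λ k → σ[ σ ] (suc k)) suc-q≡second) σ-post)) (sym σ-second′) post<v)
    where
    suc-q≡second : suc (first + length between) ≡ second
    suc-q≡second = sym (ℕₚ.+-suc first (length between))
    σ-second′ : σ[ σ ] (suc (first + length between)) ≡ v
    σ-second′ = trans (cong (σ[ σ ]_) suc-q≡second) σ-second
    q< : first + length between < n + n
    q< = subst (_< n + n) (ℕₚ.+-suc (length before) (length between)) second-1<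

  uu⇒ : Any (λ i → Any (UUAt σ v i) (positions n)) (positions n) → pre < v × v < post
  uu⇒ p with Any-positions⁻ n p
  ... | q , _ , p′ with Any-positions⁻ n p′
  ... | q′ , _ , (q<q′ , σq≡v , σq′≡v , σq-1<σq , σq′<σq′+1) with σ[]≡v⇒ (suc q) σq≡v | σ[]≡v⇒ (suc q′) σq′≡v
  ...   | inj₁ x | inj₁ y = ⊥-elim (ℕₚ.<-irrefl (trans x (sym y)) q<q′)
  ...   | inj₂ x | inj₂ y = ⊥-elim (ℕₚ.<-irrefl (trans x (sym y)) q<q′)
  ...   | inj₂ x | inj₁ y = ⊥-elim (ℕₚ.<-asym q<q′ (subst₂ _<_ (sym y) (sym x) (ℕₚ.m<m+n first z<s)))
  ...   | inj₁ refl | inj₂ y =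
    subst₂ _<_ σ-pre σq≡v σq-1<σq , subst₂ _<_ σq′≡v (trans (cong (λ k → σ[ σ ] (suc k)) y) σ-post) σq′<σq′+1

  uu⇐ : pre < v → v < post → Any (λ i → Any (UUAt σ v i) (positions n)) (positions n)
  uu⇐ pre<v v<post = Any-positions⁺ n (length before) before< (Any-positions⁺ n (length before + suc (length between)) second-1<
      ( ℕₚ.m<m+n first z<s , σ-first , σ-second
      , subst₂ _<_ (sym σ-pre) (sym σ-first) pre<v
      , subst₂ _<_ (sym σ-second) (sym σ-post) v<post))

  flag-left : (v , left) ∈ᵇ gaps σ ≡ does (pre <? v)
  flag-left = does-⇔ (mk⇔ (gap-present⁻ left) (gap-present⁺ left)) ((v , left) ∈? gaps σ) (pre <? v)

  flag-plateau : (v , plateau) ∈ᵇ gaps σ ≡ does (≡[]? between)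
  flag-plateau = does-⇔ (mk⇔ (gap-present⁻ plateau) (gap-present⁺ plateau)) ((v , plateau) ∈? gaps σ) (≡[]? between)

  flag-right : (v , right) ∈ᵇ gaps σ ≡ does (post <? v)
  flag-right = does-⇔ (mk⇔ (gap-present⁻ right) (gap-present⁺ right)) ((v , right) ∈? gaps σ) (post <? v)

  dplat-flags : does (any? (DPlatAt? σ v) (positions n)) ≡ not ((v , left) ∈ᵇ gaps σ) ∧ (v , plateau) ∈ᵇ gaps σ
  dplat-flags = trans
    (does-⇔ (mk⇔ dplat⇒ (λ (a , b) → dplat⇐ a b)) (any? (DPlatAt? σ v) (positions n)) ((v <? pre) ×-dec ≡[]? between))
    (cong₂ _∧_ (trans (does-<-flip pre v pre≢v) (cong not (sym flag-left))) (sym flag-plateau))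

  ddes-flags : does (any? (DDesAt? σ v) (positions n)) ≡ not ((v , plateau) ∈ᵇ gaps σ) ∧ (v , right) ∈ᵇ gaps σ
  ddes-flags = trans
    (does-⇔ (mk⇔ ddes⇒ (λ (a , b) → ddes⇐ a b)) (any? (DDesAt? σ v) (positions n)) (¬? (≡[]? between) ×-dec (post <? v)))
    (cong₂ _∧_ (cong not (sym flag-plateau)) (sym flag-right))

  uu-flags : does (any? (λ i → any? (UUAt? σ v i) (positions n)) (positions n))
             ≡ (v , left) ∈ᵇ gaps σ ∧ not ((v , right) ∈ᵇ gaps σ)
  uu-flags = trans
    (does-⇔ (mk⇔ uu⇒ (λ (a , b) → uu⇐ a b))
            (any? (λ i → any? (UUAt? σ v i) (positions n)) (positions n)) ((pre <? v) ×-dec (v <? post)))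
    (cong₂ _∧_ (sym flag-left) (trans (does-<-flip post v post≢v) (cong not (sym flag-right))))

module Sums {c ℓ} (R : CommutativeSemiring c ℓ) where
  open CommutativeSemiring R public using (Carrier; _≈_; 0#; 1#)
    renaming (_+_ to _⊕_; _*_ to _⊗_)
  open CommutativeSemiring R
    using (setoid; +-cong; +-congˡ; +-congʳ; +-assoc; +-comm; +-identityˡ; +-identityʳ;
           *-cong; *-congˡ; *-congʳ; *-assoc; *-identityˡ; *-identityʳ; zeroˡ; zeroʳ; distribˡ; distribʳ)
    renaming (refl to ≈-refl; sym to ≈-sym; trans to ≈-trans)
  open Eval R public using (∑)
  open import Algebra.Definitions.RawSemiring (CommutativeSemiring.rawSemiring R) public using (_^_) renaming (_×_ to _·_)
  open import Relation.Binary.Reasoning.Setoid setoid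

  Π : {A : Set} → List A → (A → Carrier) → Carrier
  Π xs f = foldr (λ x acc → f x ⊗ acc) 1# xs

  ∑-cong∈ : ∀ {A : Set} (xs : List A) {f g : A → Carrier} → (∀ x → x ∈ xs → f x ≈ g x) → ∑ xs f ≈ ∑ xs g
  ∑-cong∈ []       f≈g = ≈-refl
  ∑-cong∈ (x ∷ xs) f≈g = +-cong (f≈g x (here refl)) (∑-cong∈ xs (λ y p → f≈g y (there p)))

  ∑-cong : ∀ {A : Set} (xs : List A) {f g : A → Carrier} → (∀ x → f x ≈ g x) → ∑ xs f ≈ ∑ xs g
  ∑-cong xs f≈g = ∑-cong∈ xs (λ x _ → f≈g x)

  Π-cong∈ : ∀ {A : Set} (xs : List A) {f g : A → Carrier} → (∀ x → x ∈ xs → f x ≈ g x) → Π xs f ≈ Π xs g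
  Π-cong∈ []       f≈g = ≈-refl
  Π-cong∈ (x ∷ xs) f≈g = *-cong (f≈g x (here refl)) (Π-cong∈ xs (λ y p → f≈g y (there p)))

  Π-cong : ∀ {A : Set} (xs : List A) {f g : A → Carrier} → (∀ x → f x ≈ g x) → Π xs f ≈ Π xs g
  Π-cong xs f≈g = Π-cong∈ xs (λ x _ → f≈g x)

  ∑-++ : ∀ {A : Set} (xs ys : List A) (f : A → Carrier) → ∑ (xs ++ ys) f ≈ ∑ xs f ⊕ ∑ ys f
  ∑-++ []       ys f = ≈-sym (+-identityˡ _)
  ∑-++ (x ∷ xs) ys f = ≈-trans (+-congˡ (∑-++ xs ys f)) (≈-sym (+-assoc _ _ _))

  Π-++ : ∀ {A : Set} (xs ys : List A) (f : A → Carrier) → Π (xs ++ ys) f ≈ Π xs f ⊗ Π ys f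
  Π-++ []       ys f = ≈-sym (*-identityˡ _)
  Π-++ (x ∷ xs) ys f = ≈-trans (*-congˡ (Π-++ xs ys f)) (≈-sym (*-assoc _ _ _))

  ∑-concatMap : ∀ {A B : Set} (h : A → List B) (xs : List A) (f : B → Carrier) →
                ∑ (concatMap h xs) f ≈ ∑ xs (λ x → ∑ (h x) f)
  ∑-concatMap h []       f = ≈-refl
  ∑-concatMap h (x ∷ xs) f = ≈-trans (∑-++ (h x) (concatMap h xs) f) (+-congˡ (∑-concatMap h xs f))

  ∑-map : ∀ {A B : Set} (h : A → B) (xs : List A) (f : B → Carrier) → ∑ (map h xs) f ≈ ∑ xs (f ∘ h)
  ∑-map h []       f = ≈-refl
  ∑-map h (x ∷ xs) f = +-congˡ (∑-map h xs f)

  ∑-distrib-⊕ : ∀ {A : Set} (xs : List A) (f g : A → Carrier) → ∑ xs (λ x → f x ⊕ g x) ≈ ∑ xs f ⊕ ∑ xs g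
  ∑-distrib-⊕ []       f g = ≈-sym (+-identityˡ _)
  ∑-distrib-⊕ (x ∷ xs) f g = begin
    (f x ⊕ g x) ⊕ ∑ xs (λ x → f x ⊕ g x) ≈⟨ +-congˡ (∑-distrib-⊕ xs f g) ⟩
    (f x ⊕ g x) ⊕ (∑ xs f ⊕ ∑ xs g)      ≈⟨ +-assoc (f x) (g x) _ ⟩
    f x ⊕ (g x ⊕ (∑ xs f ⊕ ∑ xs g))      ≈⟨ +-congˡ (≈-trans (≈-sym (+-assoc (g x) _ _)) (+-congʳ (+-comm (g x) _))) ⟩
    f x ⊕ ((∑ xs f ⊕ g x) ⊕ ∑ xs g)      ≈⟨ +-congˡ (+-assoc _ (g x) _) ⟩
    f x ⊕ (∑ xs f ⊕ (g x ⊕ ∑ xs g))      ≈⟨ +-assoc (f x) _ _ ⟨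
    (f x ⊕ ∑ xs f) ⊕ (g x ⊕ ∑ xs g)      ∎

  ∑-distribˡ : ∀ {A : Set} (xs : List A) (a : Carrier) (f : A → Carrier) → a ⊗ ∑ xs f ≈ ∑ xs (λ x → a ⊗ f x)
  ∑-distribˡ []       a f = zeroʳ a
  ∑-distribˡ (x ∷ xs) a f = ≈-trans (distribˡ a _ _) (+-congˡ (∑-distribˡ xs a f))

  ∑-distribʳ : ∀ {A : Set} (xs : List A) (a : Carrier) (f : A → Carrier) → ∑ xs f ⊗ a ≈ ∑ xs (λ x → f x ⊗ a)
  ∑-distribʳ []       a f = zeroˡ a
  ∑-distribʳ (x ∷ xs) a f = ≈-trans (distribʳ a _ _) (+-congˡ (∑-distribʳ xs a f))

  ∑-zero : ∀ {A : Set} (xs : List A) (f : A → Carrier) → (∀ x → x ∈ xs → f x ≈ 0#) → ∑ xs f ≈ 0#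
  ∑-zero []       f f≈0 = ≈-refl
  ∑-zero (x ∷ xs) f f≈0 = ≈-trans (+-cong (f≈0 x (here refl)) (∑-zero xs f (λ y p → f≈0 y (there p)))) (+-identityˡ 0#)

  ∑-comm : ∀ {A B : Set} (xs : List A) (ys : List B) (f : A → B → Carrier) →
           ∑ xs (λ x → ∑ ys (f x)) ≈ ∑ ys (λ y → ∑ xs (λ x → f x y))
  ∑-comm []       ys f = ≈-sym (∑-zero ys (λ _ → 0#) (λ _ _ → ≈-refl))
  ∑-comm (x ∷ xs) ys f = ≈-trans (+-congˡ (∑-comm xs ys f)) (≈-sym (∑-distrib-⊕ ys (f x) _))

  ∑-↭ : ∀ {A : Set} {xs ys : List A} (f : A → Carrier) → xs ↭ ys → ∑ xs f ≈ ∑ ys f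
  ∑-↭ f ↭.refl     = ≈-refl
  ∑-↭ f (↭.prep x p) = +-congˡ (∑-↭ f p)
  ∑-↭ f (↭.swap {xs} {ys} x y p) = begin
    f x ⊕ (f y ⊕ ∑ xs f) ≈⟨ +-assoc _ _ _ ⟨
    (f x ⊕ f y) ⊕ ∑ xs f ≈⟨ +-cong (+-comm _ _) (∑-↭ f p) ⟩
    (f y ⊕ f x) ⊕ ∑ ys f ≈⟨ +-assoc _ _ _ ⟩
    f y ⊕ (f x ⊕ ∑ ys f) ∎
  ∑-↭ f (↭.trans p q) = ≈-trans (∑-↭ f p) (∑-↭ f q)

  ∑-filter : ∀ {A : Set} {p} {P : Pred A p} (P? : Decidable P) (xs : List A) (f : A → Carrier) →
             (∀ x → x ∈ xs → ¬ P x → f x ≈ 0#) → ∑ xs f ≈ ∑ (filter P? xs) f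
  ∑-filter P? []       f _   = ≈-refl
  ∑-filter P? (x ∷ xs) f f≈0 with P? x
  ... | yes _ = +-congˡ (∑-filter P? xs f (λ y p → f≈0 y (there p)))
  ... | no ¬p = ≈-trans (+-cong (f≈0 x (here refl) ¬p) (∑-filter P? xs f (λ y p → f≈0 y (there p)))) (+-identityˡ _)

  Π-zero : ∀ {A : Set} (xs : List A) (f : A → Carrier) {v} → v ∈ xs → f v ≈ 0# → Π xs f ≈ 0#
  Π-zero (x ∷ xs) f (here refl) fv≈0 = ≈-trans (*-congʳ fv≈0) (zeroˡ _)
  Π-zero (x ∷ xs) f (there p)     fv≈0 = ≈-trans (*-congˡ (Π-zero xs f p fv≈0)) (zeroʳ _)

  ∑-applyUpTo : ∀ (h : ℕ → ℕ) M (f : ℕ → Carrier) → ∑ (applyUpTo h M) f ≈ ∑ (upTo M) (f ∘ h)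
  ∑-applyUpTo h zero    f = ≈-refl
  ∑-applyUpTo h (suc M) f = +-congˡ (≈-trans (∑-applyUpTo (h ∘ suc) M f) (≈-sym (∑-applyUpTo suc M (f ∘ h))))

  ∑-upTo-suc : ∀ M (f : ℕ → Carrier) → ∑ (upTo (suc M)) f ≈ f 0 ⊕ ∑ (upTo M) (f ∘ suc)
  ∑-upTo-suc M f = +-congˡ (∑-applyUpTo suc M f)

  ∑-upTo-∷ʳ : ∀ M (f : ℕ → Carrier) → ∑ (upTo (suc M)) f ≈ ∑ (upTo M) f ⊕ f M
  ∑-upTo-∷ʳ M f = begin
    ∑ (upTo (suc M)) f        ≡⟨ cong (λ xs → ∑ xs f) (sym (Lₚ.upTo-∷ʳ M)) ⟩
    ∑ (upTo M ++ M ∷ []) f    ≈⟨ ∑-++ (upTo M) (M ∷ []) f ⟩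
    ∑ (upTo M) f ⊕ (f M ⊕ 0#) ≈⟨ +-congˡ (+-identityʳ _) ⟩
    ∑ (upTo M) f ⊕ f M        ∎

  ∑-upTo-shift : ∀ M (f : ℕ → Carrier) → f 0 ≈ 0# → ∑ (upTo (suc M)) f ≈ ∑ (upTo M) (f ∘ suc)
  ∑-upTo-shift M f f0≈0 = ≈-trans (∑-upTo-suc M f) (≈-trans (+-congʳ f0≈0) (+-identityˡ _))

  ∑-upTo-trim : ∀ M d (f : ℕ → Carrier) → (∀ x → M ≤ x → f x ≈ 0#) → ∑ (upTo (d + M)) f ≈ ∑ (upTo M) f
  ∑-upTo-trim M zero    f f≈0 = ≈-refl
  ∑-upTo-trim M (suc d) f f≈0 = begin
    ∑ (upTo (suc (d + M))) f        ≈⟨ ∑-upTo-∷ʳ (d + M) f ⟩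
    ∑ (upTo (d + M)) f ⊕ f (d + M)  ≈⟨ +-cong (∑-upTo-trim M d f f≈0) (f≈0 _ (ℕₚ.m≤n+m M d)) ⟩
    ∑ (upTo M) f ⊕ 0#               ≈⟨ +-identityʳ _ ⟩
    ∑ (upTo M) f                    ∎

  ∑-upTo-single : ∀ M a (f : ℕ → Carrier) → a < M → (∀ x → x ≢ a → f x ≈ 0#) → ∑ (upTo M) f ≈ f a
  ∑-upTo-single (suc M) a f a<M f≈0 with a ≟ M
  ... | yes refl = ≈-trans (∑-upTo-∷ʳ M f)
      (≈-trans (+-congʳ (∑-zero (upTo M) f (λ x p → f≈0 x (λ e → ℕₚ.<-irrefl e (∈-upTo⁻ p))))) (+-identityˡ _))
  ... | no a≢M = ≈-trans (∑-upTo-∷ʳ M f)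
      (≈-trans (+-cong (∑-upTo-single M a f (ℕₚ.≤∧≢⇒< (ℕₚ.≤-pred a<M) a≢M) f≈0) (f≈0 M (λ e → a≢M (sym e))))
               (+-identityʳ _))

  ×-zeroʳ : ∀ k → k · 0# ≈ 0#
  ×-zeroʳ zero    = ≈-refl
  ×-zeroʳ (suc k) = ≈-trans (+-identityˡ _) (×-zeroʳ k)

  Π-range1-suc : ∀ n (f : ℕ → Carrier) → Π (range1 (suc n)) f ≈ Π (range1 n) f ⊗ f (suc n)
  Π-range1-suc n f = begin
    Π (range1 (suc n)) f           ≡⟨ cong (λ xs → Π xs f) (range1-suc n) ⟩
    Π (range1 n ++ suc n ∷ []) f   ≈⟨ Π-++ (range1 n) (suc n ∷ []) f ⟩
    Π (range1 n) f ⊗ (f (suc n) ⊗ 1#) ≈⟨ *-congˡ (*-identityʳ _) ⟩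
    Π (range1 n) f ⊗ f (suc n)     ∎

  ∑-enumeration : ∀ n (Q : List (List ℕ)) → Unique Q → (∀ σ → (σ ∈ Q) ⇔ IsStirling n σ) →
                  (f : List ℕ → Carrier) → ∑ Q f ≈ ∑ (stirlings n) f
  ∑-enumeration n Q unique enumerates f = ∑-↭ f (Unique-same-∈⇒↭ Q (stirlings n) unique (stirlings-unique n)
    λ σ → mk⇔ (IsStirling⇒∈stirlings n σ ∘ Equivalence.to (enumerates σ))
              (Equivalence.from (enumerates σ) ∘ ∈stirlings⇒IsStirling n))

isDPlat isDDes isUU : Flags → Bool
isDPlat (l , a , r) = not l ∧ a
isDDes  (l , a , r) = not a ∧ r
isUU    (l , a , r) = l ∧ not r

countᵇ : (ℕ → Bool) → List ℕ → ℕ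
countᵇ p []       = 0
countᵇ p (x ∷ xs) = if p x then suc (countᵇ p xs) else countᵇ p xs

length-filter : ∀ {P : ℕ → Set} (P? : ∀ x → Dec (P x)) xs → length (filter P? xs) ≡ countᵇ (λ x → does (P? x)) xs
length-filter P? []       = refl
length-filter P? (x ∷ xs) with does (P? x)
... | true  = cong suc (length-filter P? xs)
... | false = length-filter P? xs

countᵇ-cong∈ : ∀ (p q : ℕ → Bool) xs → (∀ x → x ∈ xs → p x ≡ q x) → countᵇ p xs ≡ countᵇ q xs
countᵇ-cong∈ p q []       _   = refl
countᵇ-cong∈ p q (x ∷ xs) p≡q with p x | q x | p≡q x (here refl)
... | true  | .true  | refl = cong suc (countᵇ-cong∈ p q xs (λ y r → p≡q y (there r)))
... | false | .false | refl = countᵇ-cong∈ p q xs (λ y r → p≡q y (there r))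

module Weights {c ℓ} (R : CommutativeSemiring c ℓ) (β₁ β₄ β₅ : CommutativeSemiring.Carrier R) where
  open Sums R
  open CommutativeSemiring R using (*-assoc; *-congˡ; *-identityˡ)
    renaming (refl to ≈-refl; reflexive to ≈-reflexive; sym to ≈-sym; trans to ≈-trans)
  open import Algebra.Solver.Ring.NaturalCoefficients.Default R

  weight : Flags → Carrier
  weight fs = if isDPlat fs then β₁ else if isDDes fs then β₅ else if isUU fs then β₄ else 1#

  monomial : ℕ → List ℕ → Carrier
  monomial n σ = (β₁ ^ dplat n σ) ⊗ ((β₄ ^ uu n σ) ⊗ (β₅ ^ ddes n σ))

  middle-to-front : ∀ a b c d → b ⊗ ((a ⊗ c) ⊗ d) ≈ a ⊗ (b ⊗ (c ⊗ d))
  middle-to-front = solve 4 (λ a b c d → b :* ((a :* c) :* d) := a :* (b :* (c :* d))) ≈-refl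

  last-to-front : ∀ a b c d → b ⊗ (c ⊗ (a ⊗ d)) ≈ a ⊗ (b ⊗ (c ⊗ d))
  last-to-front = solve 4 (λ a b c d → b :* (c :* (a :* d)) := a :* (b :* (c :* d))) ≈-refl

  powers≈Π-weight : ∀ (F : ℕ → Flags) xs →
    β₁ ^ countᵇ (isDPlat ∘ F) xs ⊗ (β₄ ^ countᵇ (isUU ∘ F) xs ⊗ β₅ ^ countᵇ (isDDes ∘ F) xs) ≈ Π xs (weight ∘ F)
  powers≈Π-weight F [] = ≈-trans (*-identityˡ _) (*-identityˡ _)
  powers≈Π-weight F (x ∷ xs) with F x | powers≈Π-weight F xs
  ... | true  , true  , true  | ih = ≈-trans (≈-sym (*-identityˡ _)) (*-congˡ ih)
  ... | false , false , false | ih = ≈-trans (≈-sym (*-identityˡ _)) (*-congˡ ih)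
  ... | false , true  , _     | ih = ≈-trans (*-assoc _ _ _) (*-congˡ ih)
  ... | true  , false , true  | ih = ≈-trans (last-to-front _ _ _ _) (*-congˡ ih)
  ... | false , false , true  | ih = ≈-trans (last-to-front _ _ _ _) (*-congˡ ih)
  ... | true  , true  , false | ih = ≈-trans (middle-to-front _ _ _ _) (*-congˡ ih)
  ... | true  , false , false | ih = ≈-trans (middle-to-front _ _ _ _) (*-congˡ ih)

  monomial≈Π-weight : ∀ n {σ} → σ ∈ stirlings n → monomial n σ ≈ Π (range1 n) (weight ∘ flags σ)
  monomial≈Π-weight n {σ} σ∈ =
    ≈-trans (≈-reflexive (cong₂ (λ a b → β₁ ^ a ⊗ b) dplat≡ (cong₂ (λ a b → β₄ ^ a ⊗ β₅ ^ b) uu≡ ddes≡)))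
            (powers≈Π-weight (flags σ) (range1 n))
    where
    I : Invariant n σ
    I = stirlings-invariant n σ∈
    module V {v} (v∈ : v ∈ range1 n) = ValueStatistics I (proj₁ (∈-range1⁻ v∈)) (proj₂ (∈-range1⁻ v∈))
    dplat≡ : dplat n σ ≡ countᵇ (isDPlat ∘ flags σ) (range1 n)
    dplat≡ = trans (length-filter _ (range1 n)) (countᵇ-cong∈ _ _ (range1 n) (λ _ p → V.dplat-flags p))
    uu≡ : uu n σ ≡ countᵇ (isUU ∘ flags σ) (range1 n)
    uu≡ = trans (length-filter _ (range1 n)) (countᵇ-cong∈ _ _ (range1 n) (λ _ p → V.uu-flags p))
    ddes≡ : ddes n σ ≡ countᵇ (isDDes ∘ flags σ) (range1 n)
    ddes≡ = trans (length-filter _ (range1 n)) (countᵇ-cong∈ _ _ (range1 n) (λ _ p → V.ddes-flags p))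

-- Expansion over insertion histories

≡ᵇ-refl : ∀ v → (v ≡ᵇ v) ≡ true
≡ᵇ-refl v = dec-true (v ≟ v) refl

≡ᵇ-≢ : ∀ {w v} → w ≢ v → (w ≡ᵇ v) ≡ false
≡ᵇ-≢ {w} {v} w≢v = dec-false (w ≟ v) w≢v

bump : (ℕ → ℕ) → ℕ → ℕ → ℕ
bump s v w = if w ≡ᵇ v then suc (s w) else s w

bump-≡ : ∀ s v → bump s v v ≡ suc (s v)
bump-≡ s v rewrite ≡ᵇ-refl v = refl

bump-≢ : ∀ s {v w} → w ≢ v → bump s v w ≡ s w
bump-≢ s w≢v rewrite ≡ᵇ-≢ w≢v = refl

available : (ℕ → ℕ) → ℕ → List ℕ
available s n = filter (λ v → s v <? 3) (range1 n)

-- One entry for each sequence of k insertions into 11, recording for every value the number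
-- of its gaps used up.
histories : ℕ → List (ℕ → ℕ)
histories zero    = (λ _ → 0) ∷ []
histories (suc k) = concatMap (λ s → map (bump s) (available s (suc k))) (histories k)

∈-available⁻ : ∀ {s v} n → v ∈ available s n → v ∈ range1 n × s v < 3
∈-available⁻ {s} n = ∈-filter⁻ (λ v → s v <? 3) {xs = range1 n}

range1-≢ : ∀ {n v} → v ∈ range1 n → v ≢ suc n
range1-≢ v∈ e = ℕₚ.<-irrefl e (s≤s (proj₂ (∈-range1⁻ v∈)))

histories-beyond : ∀ k {s} → s ∈ histories k → ∀ w → suc k < w → s w ≡ 0
histories-beyond zero    (here refl) w _ = refl
histories-beyond (suc k) p w k+1<w
  with find (∈-concatMap⁻ (λ s → map (bump s) (available s (suc k))) {xs = histories k} p)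
... | s , s∈ , q with ∈-map⁻ (bump s) q
... | v , v∈ , refl = trans (bump-≢ s w≢v) (histories-beyond k s∈ w (ℕₚ.<-trans (s≤s ℕₚ.≤-refl) k+1<w))
  where
  w≢v : w ≢ v
  w≢v e = ℕₚ.<⇒≱ k+1<w (ℕₚ.m≤n⇒m≤1+n (subst (_≤ suc k) (sym e) (proj₂ (∈-range1⁻ (proj₁ (∈-available⁻ {s} (suc k) v∈))))))

==ᵍ-refl : ∀ ℓ → (ℓ ==ᵍ ℓ) ≡ true
==ᵍ-refl ℓ = dec-true (ℓ ≟ᵍ ℓ) refl

==ᵍ-≢ : ∀ {ℓ ℓ′} → ℓ ≢ ℓ′ → (ℓ ==ᵍ ℓ′) ≡ false
==ᵍ-≢ {ℓ} {ℓ′} ℓ≢ℓ′ = dec-false (ℓ ≟ᵍ ℓ′) ℓ≢ℓ′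

bump-new : ∀ k {s} → s ∈ histories k → ∀ {v} → v ∈ range1 (suc k) → bump s v (2 + k) ≡ 0
bump-new k {s} s∈ v∈ = trans (bump-≢ s (λ e → range1-≢ v∈ (sym e))) (histories-beyond k s∈ (2 + k) ℕₚ.≤-refl)

consume-≢ : ∀ {v w} s fs → w ≢ v → consume (v , s) w fs ≡ fs
consume-≢ {v} {w} s (l , a , r) w≢v
  rewrite ==ᵍ-≢ {w , left} {v , s} (λ e → w≢v (cong proj₁ e))
        | ==ᵍ-≢ {w , plateau} {v , s} (λ e → w≢v (cong proj₁ e))
        | ==ᵍ-≢ {w , right} {v , s} (λ e → w≢v (cong proj₁ e))
        | Boolₚ.∧-identityʳ l | Boolₚ.∧-identityʳ a | Boolₚ.∧-identityʳ r = refl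

consume-left : ∀ v a r → consume (v , left) v (true , a , r) ≡ (false , a , r)
consume-left v a r
  rewrite ==ᵍ-refl (v , left) | ==ᵍ-≢ {v , plateau} {v , left} (λ ()) | ==ᵍ-≢ {v , right} {v , left} (λ ())
        | Boolₚ.∧-identityʳ a | Boolₚ.∧-identityʳ r = refl

consume-plateau : ∀ v l r → consume (v , plateau) v (l , true , r) ≡ (l , false , r)
consume-plateau v l r
  rewrite ==ᵍ-refl (v , plateau) | ==ᵍ-≢ {v , left} {v , plateau} (λ ()) | ==ᵍ-≢ {v , right} {v , plateau} (λ ())
        | Boolₚ.∧-identityʳ l | Boolₚ.∧-identityʳ r = refl

consume-right : ∀ v l a → consume (v , right) v (l , a , true) ≡ (l , a , false)
consume-right v l a
  rewrite ==ᵍ-refl (v , right) | ==ᵍ-≢ {v , left} {v , right} (λ ()) | ==ᵍ-≢ {v , plateau} {v , right} (λ ())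
        | Boolₚ.∧-identityʳ l | Boolₚ.∧-identityʳ a = refl

module Expansion {c ℓ} (R : CommutativeSemiring c ℓ) where
  open Sums R
  open CommutativeSemiring R
    using (setoid; +-cong; +-congˡ; +-congʳ; +-identityˡ; +-identityʳ; *-cong; *-congˡ; *-congʳ; *-comm)
    renaming (refl to ≈-refl; reflexive to ≈-reflexive; sym to ≈-sym; trans to ≈-trans)
  open import Algebra.Properties.Monoid.Mult (CommutativeSemiring.+-monoid R) using (×-congʳ)
  open import Algebra.Solver.Ring.NaturalCoefficients.Default R
  open import Relation.Binary.Reasoning.Setoid setoid

  removeOne : (Flags → Carrier) → Flags → Carrier
  removeOne φ (l , a , r) =
    (if l then φ (false , a , r) else 0#) ⊕ ((if a then φ (l , false , r) else 0#) ⊕ (if r then φ (l , a , false) else 0#))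

  -- φ summed over the ordered ways of removing t of the three gaps of a new value.
  afterRemovals : (Flags → Carrier) → ℕ → Carrier
  afterRemovals φ 0 = φ fresh
  afterRemovals φ 1 = φ (false , true , true) ⊕ (φ (true , false , true) ⊕ φ (true , true , false))
  afterRemovals φ 2 = 2 · (φ (true , false , false) ⊕ (φ (false , true , false) ⊕ φ (false , false , true)))
  afterRemovals φ 3 = 6 · φ (false , false , false)
  afterRemovals φ (suc (suc (suc (suc _)))) = 0#

  afterRemovals-suc : ∀ φ t → t < 3 → afterRemovals φ (suc t) ≈ afterRemovals (removeOne φ) t
  afterRemovals-suc φ 0 _ = ≈-refl
  afterRemovals-suc φ 1 _ = solve 3 (λ a b c → (a :+ (b :+ c)) :+ ((a :+ (b :+ c)) :+ con 0)
                                           := (con 0 :+ (c :+ b)) :+ ((c :+ (con 0 :+ a)) :+ (b :+ (a :+ con 0))))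
                              ≈-refl (φ (true , false , false)) (φ (false , true , false)) (φ (false , false , true))
  afterRemovals-suc φ 2 _ = solve 1 (λ a → a :+ (a :+ (a :+ (a :+ (a :+ (a :+ con 0)))))
                                       := (a :+ (con 0 :+ con 0)) :+ ((con 0 :+ (a :+ con 0)) :+ (con 0 :+ (con 0 :+ a)))
                                          :+ (((a :+ (con 0 :+ con 0)) :+ ((con 0 :+ (a :+ con 0)) :+ (con 0 :+ (con 0 :+ a)))) :+ con 0))
                              ≈-refl (φ (false , false , false))
  afterRemovals-suc φ (suc (suc (suc t))) (s≤s (s≤s (s≤s ())))

  afterRemovals-removeOne-≥3 : ∀ φ t → ¬ (t < 3) → afterRemovals (removeOne φ) t ≈ 0#
  afterRemovals-removeOne-≥3 φ 0 t≮3 = ⊥-elim (t≮3 (s≤s z≤n))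
  afterRemovals-removeOne-≥3 φ 1 t≮3 = ⊥-elim (t≮3 (s≤s (s≤s z≤n)))
  afterRemovals-removeOne-≥3 φ 2 t≮3 = ⊥-elim (t≮3 (s≤s (s≤s (s≤s z≤n))))
  afterRemovals-removeOne-≥3 φ 3 _   = ≈-trans (×-congʳ 6 (≈-trans (+-identityˡ _) (+-identityˡ _))) (×-zeroʳ 6)
  afterRemovals-removeOne-≥3 φ (suc (suc (suc (suc _)))) _ = ≈-refl

  removeOneAt : (ℕ → Flags → Carrier) → ℕ → ℕ → Flags → Carrier
  removeOneAt Φ v w = if w ≡ᵇ v then removeOne (Φ w) else Φ w

  removeOneAt-≡ : ∀ Φ v → removeOneAt Φ v v ≡ removeOne (Φ v)
  removeOneAt-≡ Φ v rewrite ≡ᵇ-refl v = refl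

  removeOneAt-≢ : ∀ Φ {v w} → w ≢ v → removeOneAt Φ v w ≡ Φ w
  removeOneAt-≢ Φ w≢v rewrite ≡ᵇ-≢ w≢v = refl

  ∑-Π-single : ∀ {L : Set} xs → Unique xs → ∀ {v} → v ∈ xs →
               (ℓs : List L) (F : L → ℕ → Carrier) (G : ℕ → Carrier) →
               (∀ ℓ → ℓ ∈ ℓs → ∀ w → w ≢ v → F ℓ w ≈ G w) → ∑ ℓs (λ ℓ → F ℓ v) ≈ G v →
               ∑ ℓs (λ ℓ → Π xs (F ℓ)) ≈ Π xs G
  ∑-Π-single (x ∷ xs) (x∉ ∷ _) (here refl) ℓs F G F≈G ∑F≈G = begin
    ∑ ℓs (λ ℓ → F ℓ x ⊗ Π xs (F ℓ)) ≈⟨ ∑-cong∈ ℓs (λ ℓ p → *-congˡ (Π-cong∈ xs (λ w q → F≈G ℓ p w (λ e → All.lookup x∉ q (sym e))))) ⟩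
    ∑ ℓs (λ ℓ → F ℓ x ⊗ Π xs G)     ≈⟨ ∑-distribʳ ℓs _ _ ⟨
    ∑ ℓs (λ ℓ → F ℓ x) ⊗ Π xs G     ≈⟨ *-congʳ ∑F≈G ⟩
    G x ⊗ Π xs G                     ∎
  ∑-Π-single (x ∷ xs) (x∉ ∷ u) (there p) ℓs F G F≈G ∑F≈G = begin
    ∑ ℓs (λ ℓ → F ℓ x ⊗ Π xs (F ℓ)) ≈⟨ ∑-cong∈ ℓs (λ ℓ q → *-congʳ (F≈G ℓ q x (λ e → All.lookup x∉ p e))) ⟩
    ∑ ℓs (λ ℓ → G x ⊗ Π xs (F ℓ))   ≈⟨ ∑-distribˡ ℓs _ _ ⟨
    G x ⊗ ∑ ℓs (λ ℓ → Π xs (F ℓ))   ≈⟨ *-congˡ (∑-Π-single xs u p ℓs F G F≈G ∑F≈G) ⟩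
    G x ⊗ Π xs G                     ∎

  ∑-ownGaps-consume : ∀ φ v fs → ∑ (ownGaps v fs) (λ ℓ → φ (consume ℓ v fs)) ≈ removeOne φ fs
  ∑-ownGaps-consume φ v (l , a , r) =
    ≈-trans (∑-++ (side l left) _ f) (≈-trans (+-congˡ (∑-++ (side a plateau) (side r right) f))
      (+-cong (at-left l) (+-cong (at-plateau a) (at-right r))))
    where
    side : Bool → Side → List Gap
    side b s = if b then (v , s) ∷ [] else []
    f : Gap → Carrier
    f ℓ = φ (consume ℓ v (l , a , r))
    at-left : ∀ l → ∑ (side l left) (λ ℓ → φ (consume ℓ v (l , a , r))) ≈ (if l then φ (false , a , r) else 0#)
    at-left true  = ≈-trans (+-identityʳ _) (≈-reflexive (cong φ (consume-left v a r)))
    at-left false = ≈-refl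
    at-plateau : ∀ a → ∑ (side a plateau) (λ ℓ → φ (consume ℓ v (l , a , r))) ≈ (if a then φ (l , false , r) else 0#)
    at-plateau true  = ≈-trans (+-identityʳ _) (≈-reflexive (cong φ (consume-plateau v l r)))
    at-plateau false = ≈-refl
    at-right : ∀ r → ∑ (side r right) (λ ℓ → φ (consume ℓ v (l , a , r))) ≈ (if r then φ (l , a , false) else 0#)
    at-right true  = ≈-trans (+-identityʳ _) (≈-reflexive (cong φ (consume-right v l a)))
    at-right false = ≈-refl

  ∑-gapAt : ∀ (ℓs : List Gap) (H : Gap → Carrier) → ∑ (upTo (length ℓs)) (λ g → H (gapAt ℓs g)) ≈ ∑ ℓs H
  ∑-gapAt []       H = ≈-refl
  ∑-gapAt (ℓ ∷ ℓs) H = ≈-trans (∑-upTo-suc (length ℓs) _) (+-congˡ (∑-gapAt ℓs H))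

  stirlingSum : ℕ → (ℕ → Flags → Carrier) → Carrier
  stirlingSum k Φ = ∑ (stirlings (suc k)) (λ σ → Π (range1 (suc k)) (λ w → Φ w (flags σ w)))

  historySum : ℕ → (ℕ → Flags → Carrier) → Carrier
  historySum k Φ = ∑ (histories k) (λ s → Π (range1 (suc k)) (λ w → afterRemovals (Φ w) (s w)))

  Π-flags-insertPair : ∀ (Φ : ℕ → Flags → Carrier) n {σ} g → σ ∈ stirlings n → g ≤ n + n →
    Π (range1 (suc n)) (λ w → Φ w (flags (insertPair g σ (suc n)) w))
      ≈ Φ (suc n) fresh ⊗ Π (range1 n) (λ w → Φ w (consume (gapAt (gaps σ) g) w (flags σ w)))
  Π-flags-insertPair Φ n {σ} g σ∈ g≤ = begin
    Π (range1 (suc n)) (λ w → Φ w (flags τ w))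
      ≈⟨ Π-range1-suc n _ ⟩
    Π (range1 n) (λ w → Φ w (flags τ w)) ⊗ Φ (suc n) (flags τ (suc n))
      ≈⟨ *-cong (Π-cong∈ (range1 n) (λ w w∈ → ≈-reflexive (cong (Φ w) (flags-insertPair σ∈ g g≤ w (range1-≢ w∈)))))
                (≈-reflexive (cong (Φ (suc n)) (flags-inserted σ∈ g g≤))) ⟩
    Π (range1 n) (λ w → Φ w (consume (gapAt (gaps σ) g) w (flags σ w))) ⊗ Φ (suc n) fresh
      ≈⟨ *-comm _ _ ⟩
    Φ (suc n) fresh ⊗ Π (range1 n) (λ w → Φ w (consume (gapAt (gaps σ) g) w (flags σ w))) ∎
    where
    τ : List ℕ
    τ = insertPair g σ (suc n)

  ∑-ownGaps-Π : ∀ (Φ : ℕ → Flags → Carrier) (F : ℕ → Flags) n {v} → v ∈ range1 n →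
    ∑ (ownGaps v (F v)) (λ ℓ → Π (range1 n) (λ w → Φ w (consume ℓ w (F w))))
      ≈ Π (range1 n) (λ w → removeOneAt Φ v w (F w))
  ∑-ownGaps-Π Φ F n {v} v∈ = ∑-Π-single (range1 n) (range1-unique n) v∈ (ownGaps v (F v))
    (λ ℓ w → Φ w (consume ℓ w (F w))) (λ w → removeOneAt Φ v w (F w)) elsewhere at-v
    where
    elsewhere : ∀ ℓ → ℓ ∈ ownGaps v (F v) → ∀ w → w ≢ v → Φ w (consume ℓ w (F w)) ≈ removeOneAt Φ v w (F w)
    elsewhere ℓ p w w≢v with ∈-ownGaps⁻ v (F v) p
    ... | s , refl , _ = ≈-reflexive (trans (cong (Φ w) (consume-≢ s (F w) w≢v))
                                                 (sym (cong (λ φ → φ (F w)) (removeOneAt-≢ Φ w≢v))))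
    at-v : ∑ (ownGaps v (F v)) (λ ℓ → Φ v (consume ℓ v (F v))) ≈ removeOneAt Φ v v (F v)
    at-v = ≈-trans (∑-ownGaps-consume (Φ v) v (F v)) (≈-reflexive (sym (cong (λ φ → φ (F v)) (removeOneAt-≡ Φ v))))

  ∑-insertions : ∀ k (Φ : ℕ → Flags → Carrier) {σ} → σ ∈ stirlings (suc k) →
    ∑ (insertions (suc k) σ) (λ τ → Π (range1 (2 + k)) (λ w → Φ w (flags τ w)))
      ≈ Φ (2 + k) fresh ⊗ ∑ (range1 (suc k)) (λ v → Π (range1 (suc k)) (λ w → removeOneAt Φ v w (flags σ w)))
  ∑-insertions k Φ {σ} σ∈ = begin
    ∑ (map (λ g → insertPair g σ (2 + k)) (upTo (suc n + n))) F
      ≈⟨ ∑-map _ (upTo (suc n + n)) F ⟩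
    ∑ (upTo (suc n + n)) (λ g → F (insertPair g σ (2 + k)))
      ≈⟨ ∑-cong∈ (upTo (suc n + n)) (λ g g∈ → Π-flags-insertPair Φ n g σ∈ (ℕₚ.≤-pred (∈-upTo⁻ g∈))) ⟩
    ∑ (upTo (suc n + n)) (λ g → Φ₀ ⊗ H (gapAt (gaps σ) g))
      ≈⟨ ∑-distribˡ (upTo (suc n + n)) Φ₀ _ ⟨
    Φ₀ ⊗ ∑ (upTo (suc n + n)) (λ g → H (gapAt (gaps σ) g))
      ≡⟨ cong (λ M → Φ₀ ⊗ ∑ (upTo M) (λ g → H (gapAt (gaps σ) g))) (sym (length-gaps (stirlings-invariant n σ∈))) ⟩
    Φ₀ ⊗ ∑ (upTo (length (gaps σ))) (λ g → H (gapAt (gaps σ) g))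
      ≈⟨ *-congˡ (≈-trans (∑-gapAt (gaps σ) H) (∑-↭ H (gaps-↭-allOwnGaps k σ∈))) ⟩
    Φ₀ ⊗ ∑ (allOwnGaps σ n) H
      ≈⟨ *-congˡ (∑-concatMap (λ v → ownGaps v (flags σ v)) (range1 n) H) ⟩
    Φ₀ ⊗ ∑ (range1 n) (λ v → ∑ (ownGaps v (flags σ v)) H)
      ≈⟨ *-congˡ (∑-cong∈ (range1 n) (λ v v∈ → ∑-ownGaps-Π Φ (flags σ) n v∈)) ⟩
    Φ₀ ⊗ ∑ (range1 n) (λ v → Π (range1 n) (λ w → removeOneAt Φ v w (flags σ w))) ∎
    where
    n : ℕ
    n = suc k
    Φ₀ : Carrier
    Φ₀ = Φ (2 + k) fresh
    F : List ℕ → Carrier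
    F τ = Π (range1 (2 + k)) (λ w → Φ w (flags τ w))
    H : Gap → Carrier
    H ℓ = Π (range1 n) (λ w → Φ w (consume ℓ w (flags σ w)))

  stirlingSum-suc : ∀ k Φ →
    stirlingSum (suc k) Φ ≈ Φ (2 + k) fresh ⊗ ∑ (range1 (suc k)) (λ v → stirlingSum k (removeOneAt Φ v))
  stirlingSum-suc k Φ = begin
    ∑ (concatMap (insertions (suc k)) (stirlings (suc k))) F
      ≈⟨ ∑-concatMap (insertions (suc k)) (stirlings (suc k)) F ⟩
    ∑ (stirlings (suc k)) (λ σ → ∑ (insertions (suc k) σ) F)
      ≈⟨ ∑-cong∈ (stirlings (suc k)) (λ σ σ∈ → ∑-insertions k Φ σ∈) ⟩
    ∑ (stirlings (suc k)) (λ σ → Φ₀ ⊗ ∑ (range1 (suc k)) (P σ))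
      ≈⟨ ∑-distribˡ (stirlings (suc k)) Φ₀ _ ⟨
    Φ₀ ⊗ ∑ (stirlings (suc k)) (λ σ → ∑ (range1 (suc k)) (P σ))
      ≈⟨ *-congˡ (∑-comm (stirlings (suc k)) (range1 (suc k)) P) ⟩
    Φ₀ ⊗ ∑ (range1 (suc k)) (λ v → stirlingSum k (removeOneAt Φ v)) ∎
    where
    Φ₀ : Carrier
    Φ₀ = Φ (2 + k) fresh
    F : List ℕ → Carrier
    F τ = Π (range1 (2 + k)) (λ w → Φ w (flags τ w))
    P : List ℕ → ℕ → Carrier
    P σ v = Π (range1 (suc k)) (λ w → removeOneAt Φ v w (flags σ w))

  afterRemovals-bump : ∀ (Φ : ℕ → Flags → Carrier) s v → s v < 3 → ∀ w →
                       afterRemovals (Φ w) (bump s v w) ≈ afterRemovals (removeOneAt Φ v w) (s w)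
  afterRemovals-bump Φ s v sv<3 w with w ≟ v
  ... | yes refl = ≈-trans (≈-reflexive (cong (afterRemovals (Φ v)) (bump-≡ s v)))
      (≈-trans (afterRemovals-suc (Φ v) (s v) sv<3) (≈-reflexive (sym (cong (λ φ → afterRemovals φ (s v)) (removeOneAt-≡ Φ v)))))
  ... | no w≢v = ≈-reflexive (trans (cong (afterRemovals (Φ w)) (bump-≢ s w≢v))
                                      (sym (cong (λ φ → afterRemovals φ (s w)) (removeOneAt-≢ Φ w≢v))))

  Π-afterRemovals-bump : ∀ k (Φ : ℕ → Flags → Carrier) {s} → s ∈ histories k → ∀ {v} → v ∈ available s (suc k) →
    Π (range1 (2 + k)) (λ w → afterRemovals (Φ w) (bump s v w))
      ≈ Φ (2 + k) fresh ⊗ Π (range1 (suc k)) (λ w → afterRemovals (removeOneAt Φ v w) (s w))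
  Π-afterRemovals-bump k Φ {s} s∈ {v} v∈ with ∈-available⁻ {s} (suc k) v∈
  ... | v∈range , sv<3 = begin
    Π (range1 (2 + k)) (λ w → afterRemovals (Φ w) (bump s v w))
      ≈⟨ Π-range1-suc (suc k) _ ⟩
    Π (range1 (suc k)) (λ w → afterRemovals (Φ w) (bump s v w)) ⊗ afterRemovals (Φ (2 + k)) (bump s v (2 + k))
      ≈⟨ *-cong (Π-cong (range1 (suc k)) (afterRemovals-bump Φ s v sv<3))
                (≈-reflexive (cong (afterRemovals (Φ (2 + k))) (bump-new k s∈ v∈range))) ⟩
    Π (range1 (suc k)) (λ w → afterRemovals (removeOneAt Φ v w) (s w)) ⊗ Φ (2 + k) fresh
      ≈⟨ *-comm _ _ ⟩
    Φ (2 + k) fresh ⊗ Π (range1 (suc k)) (λ w → afterRemovals (removeOneAt Φ v w) (s w)) ∎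

  Π-afterRemovals-exhausted : ∀ n (Φ : ℕ → Flags → Carrier) (s : ℕ → ℕ) {v} → v ∈ range1 n → ¬ (s v < 3) →
    Π (range1 n) (λ w → afterRemovals (removeOneAt Φ v w) (s w)) ≈ 0#
  Π-afterRemovals-exhausted n Φ s {v} v∈ sv≮3 = Π-zero (range1 n) (λ w → afterRemovals (removeOneAt Φ v w) (s w)) v∈
    (≈-trans (≈-reflexive (cong (λ φ → afterRemovals φ (s v)) (removeOneAt-≡ Φ v))) (afterRemovals-removeOne-≥3 (Φ v) (s v) sv≮3))

  historySum-suc : ∀ k Φ →
    historySum (suc k) Φ ≈ Φ (2 + k) fresh ⊗ ∑ (range1 (suc k)) (λ v → historySum k (removeOneAt Φ v))
  historySum-suc k Φ = begin
    ∑ (concatMap (λ s → map (bump s) (available s (suc k))) (histories k)) G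
      ≈⟨ ∑-concatMap (λ s → map (bump s) (available s (suc k))) (histories k) G ⟩
    ∑ (histories k) (λ s → ∑ (map (bump s) (available s (suc k))) G)
      ≈⟨ ∑-cong (histories k) (λ s → ∑-map (bump s) (available s (suc k)) G) ⟩
    ∑ (histories k) (λ s → ∑ (available s (suc k)) (λ v → G (bump s v)))
      ≈⟨ ∑-cong∈ (histories k) (λ s s∈ → ∑-cong∈ (available s (suc k)) (λ v v∈ → Π-afterRemovals-bump k Φ s∈ v∈)) ⟩
    ∑ (histories k) (λ s → ∑ (available s (suc k)) (λ v → Φ₀ ⊗ T s v))
      ≈⟨ ∑-cong (histories k) (λ s → ∑-distribˡ (available s (suc k)) Φ₀ (T s)) ⟨
    ∑ (histories k) (λ s → Φ₀ ⊗ ∑ (available s (suc k)) (T s))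
      ≈⟨ ∑-cong (histories k) (λ s → *-congˡ (∑-filter (λ v → s v <? 3) (range1 (suc k)) (T s)
                                               (λ v v∈ → Π-afterRemovals-exhausted (suc k) Φ s v∈))) ⟨
    ∑ (histories k) (λ s → Φ₀ ⊗ ∑ (range1 (suc k)) (T s))
      ≈⟨ ∑-distribˡ (histories k) Φ₀ _ ⟨
    Φ₀ ⊗ ∑ (histories k) (λ s → ∑ (range1 (suc k)) (T s))
      ≈⟨ *-congˡ (∑-comm (histories k) (range1 (suc k)) T) ⟩
    Φ₀ ⊗ ∑ (range1 (suc k)) (λ v → historySum k (removeOneAt Φ v)) ∎
    where
    Φ₀ : Carrier
    Φ₀ = Φ (2 + k) fresh
    G : (ℕ → ℕ) → Carrier
    G s = Π (range1 (2 + k)) (λ w → afterRemovals (Φ w) (s w))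
    T : (ℕ → ℕ) → ℕ → Carrier
    T s v = Π (range1 (suc k)) (λ w → afterRemovals (removeOneAt Φ v w) (s w))

  stirlingSum≈historySum : ∀ k Φ → stirlingSum k Φ ≈ historySum k Φ
  stirlingSum≈historySum zero    Φ = ≈-refl
  stirlingSum≈historySum (suc k) Φ = begin
    stirlingSum (suc k) Φ
      ≈⟨ stirlingSum-suc k Φ ⟩
    Φ (2 + k) fresh ⊗ ∑ (range1 (suc k)) (λ v → stirlingSum k (removeOneAt Φ v))
      ≈⟨ *-congˡ (∑-cong (range1 (suc k)) (λ v → stirlingSum≈historySum k (removeOneAt Φ v))) ⟩
    Φ (2 + k) fresh ⊗ ∑ (range1 (suc k)) (λ v → historySum k (removeOneAt Φ v))
      ≈⟨ historySum-suc k Φ ⟨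
    historySum (suc k) Φ ∎

-- Counting values by the number of gaps left

orderings : ℕ → ℕ
orderings 0 = 1
orderings 1 = 1
orderings 2 = 2
orderings 3 = 6
orderings (suc (suc (suc (suc _)))) = 0

orderings-suc : ∀ t → t < 3 → orderings (suc t) ≡ orderings t * suc t
orderings-suc 0 _ = refl
orderings-suc 1 _ = refl
orderings-suc 2 _ = refl
orderings-suc (suc (suc (suc t))) (s≤s (s≤s (s≤s ())))

indicator : Bool → ℕ
indicator true  = 1
indicator false = 0

count : ℕ → List ℕ → (ℕ → ℕ) → ℕ
count t []       s = 0
count t (w ∷ ws) s = indicator (s w ≡ᵇ t) + count t ws s

multiplicity : List ℕ → (ℕ → ℕ) → ℕ
multiplicity []       s = 1
multiplicity (w ∷ ws) s = orderings (s w) * multiplicity ws s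

multiplicity-cong∈ : ∀ ws s s′ → (∀ w → w ∈ ws → s w ≡ s′ w) → multiplicity ws s ≡ multiplicity ws s′
multiplicity-cong∈ []       s s′ s≡s′ = refl
multiplicity-cong∈ (w ∷ ws) s s′ s≡s′ =
  cong₂ (λ a b → orderings a * b) (s≡s′ w (here refl)) (multiplicity-cong∈ ws s s′ (λ y p → s≡s′ y (there p)))

count-cong∈ : ∀ t ws s s′ → (∀ w → w ∈ ws → s w ≡ s′ w) → count t ws s ≡ count t ws s′
count-cong∈ t []       s s′ s≡s′ = refl
count-cong∈ t (w ∷ ws) s s′ s≡s′ =
  cong₂ (λ a b → indicator (a ≡ᵇ t) + b) (s≡s′ w (here refl)) (count-cong∈ t ws s s′ (λ y p → s≡s′ y (there p)))

multiplicity-bump : ∀ ws → Unique ws → ∀ s {v} → v ∈ ws → s v < 3 →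
                    multiplicity ws (bump s v) ≡ multiplicity ws s * suc (s v)
multiplicity-bump (w ∷ ws) (w∉ ∷ _) s (here refl) sv<3 = begin
  orderings (bump s w w) * multiplicity ws (bump s w)   ≡⟨ cong₂ _*_ (trans (cong orderings (bump-≡ s w)) (orderings-suc (s w) sv<3))
                                                                      (multiplicity-cong∈ ws (bump s w) s (λ x p → bump-≢ s (λ e → All.lookup w∉ p (sym e)))) ⟩
  orderings (s w) * suc (s w) * multiplicity ws s       ≡⟨ *-CS.xy∙z≈xz∙y (orderings (s w)) (suc (s w)) _ ⟩
  orderings (s w) * multiplicity ws s * suc (s w)       ∎
  where open ≡-Reasoning
multiplicity-bump (w ∷ ws) (w∉ ∷ u) s {v} (there p) sv<3 = begin
  orderings (bump s v w) * multiplicity ws (bump s v)   ≡⟨ cong₂ _*_ (cong orderings (bump-≢ s (λ e → All.lookup w∉ p e))) (multiplicity-bump ws u s p sv<3) ⟩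
  orderings (s w) * (multiplicity ws s * suc (s v))     ≡⟨ ℕₚ.*-assoc (orderings (s w)) _ _ ⟨
  orderings (s w) * multiplicity ws s * suc (s v)       ∎
  where open ≡-Reasoning

count-bump : ∀ t ws → Unique ws → ∀ s {v} → v ∈ ws →
  count t ws (bump s v) + indicator (s v ≡ᵇ t) ≡ count t ws s + indicator (suc (s v) ≡ᵇ t)
count-bump t (w ∷ ws) (w∉ ∷ _) s (here refl) = begin
  indicator (bump s w w ≡ᵇ t) + count t ws (bump s w) + indicator (s w ≡ᵇ t)
    ≡⟨ cong₂ (λ a b → indicator (a ≡ᵇ t) + b + indicator (s w ≡ᵇ t)) (bump-≡ s w)
               (count-cong∈ t ws (bump s w) s (λ x p → bump-≢ s (λ e → All.lookup w∉ p (sym e)))) ⟩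
  indicator (suc (s w) ≡ᵇ t) + count t ws s + indicator (s w ≡ᵇ t)
    ≡⟨ +-CS.xy∙z≈zy∙x (indicator (suc (s w) ≡ᵇ t)) _ _ ⟩
  indicator (s w ≡ᵇ t) + count t ws s + indicator (suc (s w) ≡ᵇ t) ∎
  where open ≡-Reasoning
count-bump t (w ∷ ws) (w∉ ∷ u) s {v} (there p) = begin
  indicator (bump s v w ≡ᵇ t) + count t ws (bump s v) + indicator (s v ≡ᵇ t)
    ≡⟨ cong (λ a → indicator (a ≡ᵇ t) + count t ws (bump s v) + indicator (s v ≡ᵇ t)) (bump-≢ s (λ e → All.lookup w∉ p e)) ⟩
  indicator (s w ≡ᵇ t) + count t ws (bump s v) + indicator (s v ≡ᵇ t)
    ≡⟨ ℕₚ.+-assoc (indicator (s w ≡ᵇ t)) _ _ ⟩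
  indicator (s w ≡ᵇ t) + (count t ws (bump s v) + indicator (s v ≡ᵇ t))
    ≡⟨ cong (indicator (s w ≡ᵇ t) +_) (count-bump t ws u s p) ⟩
  indicator (s w ≡ᵇ t) + (count t ws s + indicator (suc (s v) ≡ᵇ t))
    ≡⟨ ℕₚ.+-assoc (indicator (s w ≡ᵇ t)) _ _ ⟨
  indicator (s w ≡ᵇ t) + count t ws s + indicator (suc (s v) ≡ᵇ t) ∎
  where open ≡-Reasoning

multiplicity-++ : ∀ xs ys s → multiplicity (xs ++ ys) s ≡ multiplicity xs s * multiplicity ys s
multiplicity-++ []       ys s = sym (ℕₚ.+-identityʳ _)
multiplicity-++ (x ∷ xs) ys s = trans (cong (orderings (s x) *_) (multiplicity-++ xs ys s)) (sym (ℕₚ.*-assoc (orderings (s x)) _ _))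

count-++ : ∀ t xs ys s → count t (xs ++ ys) s ≡ count t xs s + count t ys s
count-++ t []       ys s = refl
count-++ t (x ∷ xs) ys s = trans (cong (indicator (s x ≡ᵇ t) +_) (count-++ t xs ys s)) (sym (ℕₚ.+-assoc (indicator (s x ≡ᵇ t)) _ _))

+0≡+0 : ∀ {a b} → a + 0 ≡ b + 0 → a ≡ b
+0≡+0 {a} {b} e = trans (sym (ℕₚ.+-identityʳ a)) (trans e (ℕₚ.+-identityʳ b))

+1≡+0 : ∀ {a b} → a + 1 ≡ b + 0 → suc a ≡ b
+1≡+0 {a} {b} e = trans (ℕₚ.+-comm 1 a) (trans e (ℕₚ.+-identityʳ b))

count-range1-suc : ∀ t n s → count t (range1 (suc n)) s ≡ indicator (s (suc n) ≡ᵇ t) + count t (range1 n) s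
count-range1-suc t n s = begin
  count t (range1 (suc n)) s                               ≡⟨ cong (λ ws → count t ws s) (range1-suc n) ⟩
  count t (range1 n ++ suc n ∷ []) s                       ≡⟨ count-++ t (range1 n) (suc n ∷ []) s ⟩
  count t (range1 n) s + (indicator (s (suc n) ≡ᵇ t) + 0)  ≡⟨ ℕₚ.+-comm (count t (range1 n) s) _ ⟩
  indicator (s (suc n) ≡ᵇ t) + 0 + count t (range1 n) s    ≡⟨ cong (_+ count t (range1 n) s) (ℕₚ.+-identityʳ _) ⟩
  indicator (s (suc n) ≡ᵇ t) + count t (range1 n) s        ∎
  where open ≡-Reasoning

multiplicity-range1-suc : ∀ n s → multiplicity (range1 (suc n)) s ≡ multiplicity (range1 n) s * (orderings (s (suc n)) * 1)
multiplicity-range1-suc n s = trans (cong (λ ws → multiplicity ws s) (range1-suc n)) (multiplicity-++ (range1 n) (suc n ∷ []) s)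

module Counting {c ℓ} (R : CommutativeSemiring c ℓ) where
  open Sums R
  open CommutativeSemiring R
    using (setoid; +-cong; +-congˡ; +-congʳ; +-assoc; +-identityˡ)
    renaming (refl to ≈-refl; reflexive to ≈-reflexive; sym to ≈-sym; trans to ≈-trans)
  open import Algebra.Properties.Monoid.Mult (CommutativeSemiring.+-monoid R) using (×-congʳ; ×-assocˡ)
  open import Algebra.Properties.CommutativeMonoid.Mult (CommutativeSemiring.+-commutativeMonoid R) using (×-distrib-+)
  open import Algebra.Solver.Ring.NaturalCoefficients.Default R
  open import Relation.Binary.Reasoning.Setoid setoid

  -- X is applied to the numbers of values with one, two and three gaps left (i, j, k in γ).
  countTerm : ℕ → (ℕ → ℕ → ℕ → Carrier) → (ℕ → ℕ) → Carrier
  countTerm k X s = multiplicity ws s · X (count 2 ws s) (count 1 ws s) (count 0 ws s)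
    where
    ws : List ℕ
    ws = range1 (suc k)

  countSum : ℕ → (ℕ → ℕ → ℕ → Carrier) → Carrier
  countSum k X = ∑ (histories k) (countTerm k X)

  -- The transpose of the recurrence defining γ: countSum and γSum both step down along it.
  adjoint : (ℕ → ℕ → ℕ → Carrier) → ℕ → ℕ → ℕ → Carrier
  adjoint X i j k = k · X i (suc j) k ⊕ ((2 * j) · X (suc i) (pred j) (suc k) ⊕ (3 * i) · X (pred i) j (suc k))

  ∑-filter-by-count : ∀ s ws (h : ℕ → Carrier) →
    ∑ (filter (λ v → s v <? 3) ws) (λ v → h (s v)) ≈ count 0 ws s · h 0 ⊕ (count 1 ws s · h 1 ⊕ count 2 ws s · h 2)
  ∑-filter-by-count s []       h = ≈-sym (≈-trans (+-identityˡ _) (+-identityˡ _))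
  ∑-filter-by-count s (w ∷ ws) h = ≈-trans (∑-filter-∷ (λ v → s v <? 3) w ws (h ∘ s)) (step (s w) (∑-filter-by-count s ws h))
    where
    ∑-filter-∷ : ∀ {P : ℕ → Set} (P? : ∀ v → Dec (P v)) x xs (f : ℕ → Carrier) →
      ∑ (filter P? (x ∷ xs)) f ≈ (if does (P? x) then f x ⊕ ∑ (filter P? xs) f else ∑ (filter P? xs) f)
    ∑-filter-∷ P? x xs f with does (P? x)
    ... | true  = ≈-refl
    ... | false = ≈-refl
    step : ∀ t {S c₀ c₁ c₂} → S ≈ c₀ · h 0 ⊕ (c₁ · h 1 ⊕ c₂ · h 2) →
      (if does (t <? 3) then h t ⊕ S else S)
        ≈ (indicator (t ≡ᵇ 0) + c₀) · h 0 ⊕ ((indicator (t ≡ᵇ 1) + c₁) · h 1 ⊕ (indicator (t ≡ᵇ 2) + c₂) · h 2)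
    step 0 S≈ = ≈-trans (+-congˡ S≈) (≈-sym (+-assoc _ _ _))
    step 1 S≈ = ≈-trans (+-congˡ S≈) (solve 4 (λ a b c d → b :+ (a :+ (c :+ d)) := a :+ ((b :+ c) :+ d)) ≈-refl _ _ _ _)
    step 2 S≈ = ≈-trans (+-congˡ S≈) (solve 4 (λ a b c d → d :+ (a :+ (b :+ c)) := a :+ (b :+ (d :+ c))) ≈-refl _ _ _ _)
    step (suc (suc (suc t))) S≈ = S≈

  bumpTerm : (ℕ → ℕ → ℕ → Carrier) → ℕ → ℕ → ℕ → ℕ → ℕ → Carrier
  bumpTerm X K c₀ c₁ c₂ 0 = (K * 1) · X c₂ (suc c₁) c₀
  bumpTerm X K c₀ c₁ c₂ 1 = (K * 2) · X (suc c₂) (pred c₁) (suc c₀)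
  bumpTerm X K c₀ c₁ c₂ 2 = (K * 3) · X (pred c₂) c₁ (suc c₀)
  bumpTerm X K c₀ c₁ c₂ (suc (suc (suc _))) = 0#

  bumpTerm-counts : ∀ X (K c₀ c₁ c₂ d₀ d₁ d₂ : ℕ) t → t < 3 →
    d₀ + indicator (t ≡ᵇ 0) ≡ c₀ + indicator (suc t ≡ᵇ 0) →
    d₁ + indicator (t ≡ᵇ 1) ≡ c₁ + indicator (suc t ≡ᵇ 1) →
    d₂ + indicator (t ≡ᵇ 2) ≡ c₂ + indicator (suc t ≡ᵇ 2) →
    (K * suc t) · X d₂ d₁ (suc d₀) ≈ bumpTerm X K c₀ c₁ c₂ t
  bumpTerm-counts X K c₀ c₁ c₂ d₀ d₁ d₂ 0 _ e₀ e₁ e₂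
    rewrite +0≡+0 e₂ | sym (+1≡+0 (sym e₁)) | +1≡+0 e₀ = ≈-refl
  bumpTerm-counts X K c₀ c₁ c₂ d₀ d₁ d₂ 1 _ e₀ e₁ e₂
    rewrite +0≡+0 e₀ | cong pred (+1≡+0 e₁) | sym (+1≡+0 (sym e₂)) = ≈-refl
  bumpTerm-counts X K c₀ c₁ c₂ d₀ d₁ d₂ 2 _ e₀ e₁ e₂
    rewrite +0≡+0 e₀ | +0≡+0 e₁ | cong pred (+1≡+0 e₂) = ≈-refl
  bumpTerm-counts X K c₀ c₁ c₂ d₀ d₁ d₂ (suc (suc (suc t))) (s≤s (s≤s (s≤s ())))

  countTerm-bump : ∀ k X {s} → s ∈ histories k → ∀ {v} → v ∈ available s (suc k) →
    countTerm (suc k) X (bump s v)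
      ≈ bumpTerm X (multiplicity (range1 (suc k)) s) (count 0 (range1 (suc k)) s) (count 1 (range1 (suc k)) s) (count 2 (range1 (suc k)) s) (s v)
  countTerm-bump k X {s} s∈ {v} v∈ with ∈-available⁻ {s} (suc k) v∈
  ... | v∈ws , sv<3
    rewrite multiplicity-range1-suc (suc k) (bump s v)
          | count-range1-suc 0 (suc k) (bump s v) | count-range1-suc 1 (suc k) (bump s v) | count-range1-suc 2 (suc k) (bump s v)
          | bump-new k s∈ v∈ws
          | multiplicity-bump (range1 (suc k)) (range1-unique (suc k)) s v∈ws sv<3
    = ≈-trans (≈-reflexive (cong (_· X (count 2 ws (bump s v)) (count 1 ws (bump s v)) (suc (count 0 ws (bump s v))))
                                   (ℕₚ.*-identityʳ (multiplicity ws s * suc (s v)))))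
        (bumpTerm-counts X (multiplicity ws s) (count 0 ws s) (count 1 ws s) (count 2 ws s)
                         (count 0 ws (bump s v)) (count 1 ws (bump s v)) (count 2 ws (bump s v)) (s v) sv<3
                         (count-bump 0 ws (range1-unique (suc k)) s v∈ws) (count-bump 1 ws (range1-unique (suc k)) s v∈ws)
                         (count-bump 2 ws (range1-unique (suc k)) s v∈ws))
    where
    ws : List ℕ
    ws = range1 (suc k)

  adjoint-collect : ∀ X (K c₀ c₁ c₂ : ℕ) →
    c₀ · bumpTerm X K c₀ c₁ c₂ 0 ⊕ (c₁ · bumpTerm X K c₀ c₁ c₂ 1 ⊕ c₂ · bumpTerm X K c₀ c₁ c₂ 2) ≈ K · adjoint X c₂ c₁ c₀
  adjoint-collect X K c₀ c₁ c₂ = begin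
    c₀ · ((K * 1) · A) ⊕ (c₁ · ((K * 2) · B) ⊕ c₂ · ((K * 3) · C))
      ≈⟨ +-cong (≈-trans (regroup c₀ 1 A) (×-congʳ K (≈-reflexive (cong (_· A) (ℕₚ.*-identityˡ c₀)))))
                (+-cong (regroup c₁ 2 B) (regroup c₂ 3 C)) ⟩
    K · (c₀ · A) ⊕ (K · ((2 * c₁) · B) ⊕ K · ((3 * c₂) · C))
      ≈⟨ ≈-trans (×-distrib-+ _ _ K) (+-congˡ (×-distrib-+ _ _ K)) ⟨
    K · (c₀ · A ⊕ ((2 * c₁) · B ⊕ (3 * c₂) · C)) ∎
    where
    A B C : Carrier
    A = X c₂ (suc c₁) c₀
    B = X (suc c₂) (pred c₁) (suc c₀)
    C = X (pred c₂) c₁ (suc c₀)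
    regroup : ∀ a b x → a · ((K * b) · x) ≈ K · ((b * a) · x)
    regroup a b x = ≈-trans (×-assocˡ x a (K * b))
      (≈-trans (≈-reflexive (cong (_· x) (*-CS.x∙yz≈y∙zx a K b)))
               (≈-sym (×-assocˡ x K (b * a))))

  countSum-suc : ∀ k X → countSum (suc k) X ≈ countSum k (adjoint X)
  countSum-suc k X = begin
    ∑ (concatMap (λ s → map (bump s) (available s (suc k))) (histories k)) (countTerm (suc k) X)
      ≈⟨ ∑-concatMap (λ s → map (bump s) (available s (suc k))) (histories k) _ ⟩
    ∑ (histories k) (λ s → ∑ (map (bump s) (available s (suc k))) (countTerm (suc k) X))
      ≈⟨ ∑-cong (histories k) (λ s → ∑-map (bump s) (available s (suc k)) _) ⟩
    ∑ (histories k) (λ s → ∑ (available s (suc k)) (λ v → countTerm (suc k) X (bump s v)))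
      ≈⟨ ∑-cong∈ (histories k) (λ s s∈ → ∑-cong∈ (available s (suc k)) (λ v v∈ → countTerm-bump k X s∈ v∈)) ⟩
    ∑ (histories k) (λ s → ∑ (available s (suc k)) (λ v → T s (s v)))
      ≈⟨ ∑-cong (histories k) (λ s → ∑-filter-by-count s ws (T s)) ⟩
    ∑ (histories k) (λ s → count 0 ws s · T s 0 ⊕ (count 1 ws s · T s 1 ⊕ count 2 ws s · T s 2))
      ≈⟨ ∑-cong (histories k) (λ s → adjoint-collect X (multiplicity ws s) (count 0 ws s) (count 1 ws s) (count 2 ws s)) ⟩
    countSum k (adjoint X) ∎
    where
    ws : List ℕ
    ws = range1 (suc k)
    T : (ℕ → ℕ) → ℕ → Carrier
    T s = bumpTerm X (multiplicity ws s) (count 0 ws s) (count 1 ws s) (count 2 ws s)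

partial : ℕ → ℕ
partial t = indicator (t ≡ᵇ 2) + indicator (t ≡ᵇ 1)

module Uniform {c ℓ} (R : CommutativeSemiring c ℓ) (β₁ β₄ β₅ : CommutativeSemiring.Carrier R) where
  open Sums R
  open Weights R β₁ β₄ β₅ using (weight)
  open Expansion R using (afterRemovals; historySum)
  open Counting R using (countSum)
  open CommutativeSemiring R
    using (setoid; *-cong; +-identityʳ)
    renaming (refl to ≈-refl; reflexive to ≈-reflexive; sym to ≈-sym; trans to ≈-trans)
  open import Algebra.Properties.Monoid.Mult (CommutativeSemiring.+-monoid R) using (×-congʳ; ×-assocˡ)
  open import Algebra.Properties.Monoid.Mult (CommutativeSemiring.*-monoid R) using () renaming (×-homo-+ to ^-homo-+)
  import Algebra.Properties.Semiring.Mult (CommutativeSemiring.semiring R) as SemiringMult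
  open import Algebra.Solver.Ring.NaturalCoefficients.Default R
  open import Relation.Binary.Reasoning.Setoid setoid

  e : Carrier
  e = β₁ ⊕ β₄ ⊕ β₅

  afterRemovals-weight : ∀ t → afterRemovals weight t ≈ orderings t · (e ^ partial t)
  afterRemovals-weight 0 = ≈-sym (+-identityʳ _)
  afterRemovals-weight 1 = solve 3 (λ a b c → a :+ (c :+ b) := ((a :+ b :+ c) :* con 1) :+ con 0) ≈-refl β₁ β₄ β₅
  afterRemovals-weight 2 = solve 3 (λ a b c → (b :+ (a :+ c)) :+ ((b :+ (a :+ c)) :+ con 0)
                                        := ((a :+ b :+ c) :* con 1) :+ (((a :+ b :+ c) :* con 1) :+ con 0)) ≈-refl β₁ β₄ β₅
  afterRemovals-weight 3 = ≈-refl
  afterRemovals-weight (suc (suc (suc (suc t)))) = ≈-refl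

  ·-⊗-· : ∀ a b x y → (a · x) ⊗ (b · y) ≈ (a * b) · (x ⊗ y)
  ·-⊗-· a b x y = ≈-trans (SemiringMult.×-assoc-* a x (b · y))
                    (≈-trans (×-congʳ a (SemiringMult.×-comm-* b x y)) (×-assocˡ (x ⊗ y) a b))

  Π-afterRemovals-weight : ∀ ws s →
    Π ws (λ w → afterRemovals weight (s w)) ≈ multiplicity ws s · (e ^ (count 2 ws s + count 1 ws s))
  Π-afterRemovals-weight []       s = ≈-sym (+-identityʳ _)
  Π-afterRemovals-weight (w ∷ ws) s = begin
    afterRemovals weight (s w) ⊗ Π ws (λ w → afterRemovals weight (s w))
      ≈⟨ *-cong (afterRemovals-weight (s w)) (Π-afterRemovals-weight ws s) ⟩
    (orderings (s w) · (e ^ partial (s w))) ⊗ (multiplicity ws s · (e ^ (count 2 ws s + count 1 ws s)))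
      ≈⟨ ·-⊗-· (orderings (s w)) (multiplicity ws s) _ _ ⟩
    (orderings (s w) * multiplicity ws s) · ((e ^ partial (s w)) ⊗ (e ^ (count 2 ws s + count 1 ws s)))
      ≈⟨ ×-congʳ (orderings (s w) * multiplicity ws s) (^-homo-+ e (partial (s w)) _) ⟨
    (orderings (s w) * multiplicity ws s) · (e ^ (partial (s w) + (count 2 ws s + count 1 ws s)))
      ≡⟨ cong (λ p → (orderings (s w) * multiplicity ws s) · (e ^ p))
                (+-CS.interchange (indicator (s w ≡ᵇ 2)) (indicator (s w ≡ᵇ 1)) (count 2 ws s) (count 1 ws s)) ⟩
    (orderings (s w) * multiplicity ws s) · (e ^ (count 2 (w ∷ ws) s + count 1 (w ∷ ws) s)) ∎

  historySum-weight : ∀ k → historySum k (λ _ → weight) ≈ countSum k (λ i j _ → e ^ (i + j))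
  historySum-weight k = ∑-cong (histories k) (Π-afterRemovals-weight (range1 (suc k)))

-- The coefficients γ

γ₁ γ₂ γ₃ : ℕ → ℕ → ℕ → ℕ → ℕ
γ₁ m i j zero    = 0
γ₁ m i j (suc k) = 3 * suc i * γ (suc m) (suc i) j k
γ₂ m (suc i) j (suc k) = 2 * suc j * γ (suc m) i (suc j) k
γ₂ m _       _ _       = 0
γ₃ m i (suc j) k = k * γ (suc m) i j k
γ₃ m i zero    k = 0

γ-unfold : ∀ m i j k → γ (2 + m) i j k ≡ γ₁ m i j k + γ₂ m i j k + γ₃ m i j k
γ-unfold m zero    zero    zero    = refl
γ-unfold m zero    zero    (suc k) = refl
γ-unfold m zero    (suc j) zero    = refl
γ-unfold m zero    (suc j) (suc k) = refl
γ-unfold m (suc i) zero    zero    = refl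
γ-unfold m (suc i) zero    (suc k) = refl
γ-unfold m (suc i) (suc j) zero    = refl
γ-unfold m (suc i) (suc j) (suc k) = refl

2+suc[m+m] : ∀ m → 2 + suc (m + m) ≡ suc (suc m + suc m)
2+suc[m+m] m = cong (λ x → suc (suc x)) (sym (ℕₚ.+-suc m m))

index-γ₁ : ∀ i j k m → suc i + 2 * j + 3 * k ≡ suc (m + m) → i + 2 * j + 3 * suc k ≡ suc (suc m + suc m)
index-γ₁ i j k m e = trans (solve 3 (λ i j k → i :+ con 2 :* j :+ con 3 :* (con 1 :+ k)
                                               := con 2 :+ (con 1 :+ i :+ con 2 :* j :+ con 3 :* k)) refl i j k)
                              (trans (cong (2 +_) e) (2+suc[m+m] m))
  where open +-*-Solver

index-γ₂ : ∀ i j k m → i + 2 * suc j + 3 * k ≡ suc (m + m) → suc i + 2 * j + 3 * suc k ≡ suc (suc m + suc m)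
index-γ₂ i j k m e = trans (solve 3 (λ i j k → con 1 :+ i :+ con 2 :* j :+ con 3 :* (con 1 :+ k)
                                               := con 2 :+ (i :+ con 2 :* (con 1 :+ j) :+ con 3 :* k)) refl i j k)
                              (trans (cong (2 +_) e) (2+suc[m+m] m))
  where open +-*-Solver

index-γ₃ : ∀ i j k m → i + 2 * j + 3 * k ≡ suc (m + m) → i + 2 * suc j + 3 * k ≡ suc (suc m + suc m)
index-γ₃ i j k m e = trans (solve 3 (λ i j k → i :+ con 2 :* (con 1 :+ j) :+ con 3 :* k
                                               := con 2 :+ (i :+ con 2 :* j :+ con 3 :* k)) refl i j k)
                              (trans (cong (2 +_) e) (2+suc[m+m] m))
  where open +-*-Solver

*≡0ʳ : ∀ a {b} → b ≡ 0 → a * b ≡ 0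
*≡0ʳ a refl = ℕₚ.*-zeroʳ a

γ-off-support : ∀ n i j k → i + 2 * j + 3 * k ≢ suc (n + n) → γ n i j k ≡ 0
γ-off-support zero          i       j       k             _ = refl
γ-off-support (suc zero)    zero    zero    zero          _ = refl
γ-off-support (suc zero)    zero    zero    (suc zero)    off = ⊥-elim (off refl)
γ-off-support (suc zero)    zero    zero    (suc (suc k)) _ = refl
γ-off-support (suc zero)    zero    (suc j) k             _ = refl
γ-off-support (suc zero)    (suc i) j       k             _ = refl
γ-off-support (suc (suc m)) i j k off =
  trans (γ-unfold m i j k) (cong₂ _+_ (cong₂ _+_ (off₁ i j k off) (off₂ i j k off)) (off₃ i j k off))
  where
  Off : ℕ → ℕ → ℕ → Set
  Off i j k = i + 2 * j + 3 * k ≢ suc (suc (suc m) + suc (suc m))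
  off₁ : ∀ i j k → Off i j k → γ₁ m i j k ≡ 0
  off₁ i j zero    _   = refl
  off₁ i j (suc k) off = *≡0ʳ (3 * suc i) (γ-off-support (suc m) (suc i) j k (λ e → off (index-γ₁ i j k (suc m) e)))
  off₂ : ∀ i j k → Off i j k → γ₂ m i j k ≡ 0
  off₂ zero    j k       _   = refl
  off₂ (suc i) j zero    _   = refl
  off₂ (suc i) j (suc k) off = *≡0ʳ (2 * suc j) (γ-off-support (suc m) i (suc j) k (λ e → off (index-γ₂ i j k (suc m) e)))
  off₃ : ∀ i j k → Off i j k → γ₃ m i j k ≡ 0
  off₃ i zero    k _   = refl
  off₃ i (suc j) k off = *≡0ʳ k (γ-off-support (suc m) i j k (λ e → off (index-γ₃ i j k (suc m) e)))

bound : ℕ → ℕ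
bound n = suc (suc (n + n))

γ-beyond : ∀ n i j k {x} → bound n ≤ x → x ≤ i + 2 * j + 3 * k → γ n i j k ≡ 0
γ-beyond n i j k {x} bound≤x x≤ = γ-off-support n i j k (λ e → ℕₚ.<-irrefl refl (ℕₚ.<-≤-trans bound≤x (subst (x ≤_) e x≤)))

γ-beyondᵢ : ∀ n i j k → bound n ≤ i → γ n i j k ≡ 0
γ-beyondᵢ n i j k le = γ-beyond n i j k le (ℕₚ.≤-trans (ℕₚ.m≤m+n i (2 * j)) (ℕₚ.m≤m+n (i + 2 * j) (3 * k)))

γ-beyondⱼ : ∀ n i j k → bound n ≤ j → γ n i j k ≡ 0
γ-beyondⱼ n i j k le = γ-beyond n i j k le
  (ℕₚ.≤-trans (ℕₚ.m≤m+n j (j + 0)) (ℕₚ.≤-trans (ℕₚ.m≤n+m (2 * j) i) (ℕₚ.m≤m+n (i + 2 * j) (3 * k))))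

γ-beyondₖ : ∀ n i j k → bound n ≤ k → γ n i j k ≡ 0
γ-beyondₖ n i j k le = γ-beyond n i j k le (ℕₚ.≤-trans (ℕₚ.m≤m+n k (2 * k)) (ℕₚ.m≤n+m (3 * k) (i + 2 * j)))

bound-suc : ∀ n → bound (suc n) ≡ 2 + bound n
bound-suc n = cong (λ x → suc (suc (suc x))) (ℕₚ.+-suc n n)

module CoefficientSums {c ℓ} (R : CommutativeSemiring c ℓ) where
  open Sums R
  open Counting R using (adjoint; countSum; countSum-suc)
  open CommutativeSemiring R
    using (setoid; +-cong; +-congˡ; +-congʳ; +-assoc; +-identityˡ; +-identityʳ; +-commutativeSemigroup)
    renaming (refl to ≈-refl; reflexive to ≈-reflexive; sym to ≈-sym; trans to ≈-trans)
  open import Algebra.Properties.Monoid.Mult (CommutativeSemiring.+-monoid R) using (×-assocˡ; ×-homo-+)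
  open import Algebra.Properties.CommutativeMonoid.Mult (CommutativeSemiring.+-commutativeMonoid R) using (×-distrib-+)
  open import Algebra.Properties.CommutativeSemigroup +-commutativeSemigroup using (x∙yz≈z∙yx)
  open import Relation.Binary.Reasoning.Setoid setoid

  box : ℕ → (ℕ → ℕ → ℕ → Carrier) → Carrier
  box M f = ∑ (upTo M) λ i → ∑ (upTo M) λ j → ∑ (upTo M) λ k → f i j k

  γSum : ℕ → (ℕ → ℕ → ℕ → Carrier) → Carrier
  γSum n X = box (bound n) (λ i j k → γ n i j k · X i j k)

  box-cong : ∀ M {f g : ℕ → ℕ → ℕ → Carrier} → (∀ i j k → f i j k ≈ g i j k) → box M f ≈ box M g
  box-cong M f≈g = ∑-cong (upTo M) (λ i → ∑-cong (upTo M) (λ j → ∑-cong (upTo M) (λ k → f≈g i j k)))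

  box-⊕ : ∀ M (f g : ℕ → ℕ → ℕ → Carrier) → box M (λ i j k → f i j k ⊕ g i j k) ≈ box M f ⊕ box M g
  box-⊕ M f g = ≈-trans (∑-cong (upTo M) (λ i → ≈-trans (∑-cong (upTo M) (λ j → ∑-distrib-⊕ (upTo M) (f i j) (g i j)))
                                                         (∑-distrib-⊕ (upTo M) _ _)))
                        (∑-distrib-⊕ (upTo M) _ _)

  ·-zero : ∀ {a} x → a ≡ 0 → a · x ≈ 0#
  ·-zero x refl = ≈-refl

  ∑-upTo-zero : ∀ M (f : ℕ → Carrier) → (∀ x → f x ≈ 0#) → ∑ (upTo M) f ≈ 0#
  ∑-upTo-zero M f f≈0 = ∑-zero (upTo M) f (λ x _ → f≈0 x)

  *-· : ∀ a g x → (a * g) · x ≈ g · (a · x)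
  *-· a g x = ≈-trans (≈-reflexive (cong (_· x) (ℕₚ.*-comm a g))) (≈-sym (×-assocˡ x g a))

  module RecurrenceStep (m : ℕ) (X : ℕ → ℕ → ℕ → Carrier) where
    n₁ N : ℕ
    n₁ = suc m
    N = bound n₁
    trim : ∀ d (f : ℕ → Carrier) → (∀ x → N ≤ x → f x ≈ 0#) → ∑ (upTo (d + N)) f ≈ ∑ (upTo N) f
    trim d f h = ∑-upTo-trim N d f h

    Q₁ Q₂ Q₃ : ℕ → ℕ → ℕ → Carrier
    Q₁ i j k = γ n₁ i j k · ((3 * i) · X (pred i) j (suc k))
    Q₂ i j k = γ n₁ i j k · ((2 * j) · X (suc i) (pred j) (suc k))
    Q₃ i j k = γ n₁ i j k · (k · X i (suc j) k)

    box-γ₃ : box (2 + N) (λ i j k → γ₃ m i j k · X i j k) ≈ box N Q₃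
    box-γ₃ = ≈-trans (trim 2 _ beyond) (∑-cong (upTo N) shifted)
      where
      beyond : ∀ i → N ≤ i → ∑ (upTo (2 + N)) (λ j → ∑ (upTo (2 + N)) (λ k → γ₃ m i j k · X i j k)) ≈ 0#
      beyond i N≤i = ∑-upTo-zero (2 + N) _ (λ j → ∑-upTo-zero (2 + N) _ (vanishes j))
        where
        vanishes : ∀ j k → γ₃ m i j k · X i j k ≈ 0#
        vanishes zero    k = ≈-refl
        vanishes (suc j) k = ·-zero _ (*≡0ʳ k (γ-beyondᵢ n₁ i j k N≤i))
      shifted : ∀ i → ∑ (upTo (2 + N)) (λ j → ∑ (upTo (2 + N)) (λ k → γ₃ m i j k · X i j k))
                      ≈ ∑ (upTo N) (λ j → ∑ (upTo N) (λ k → Q₃ i j k))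
      shifted i = begin
        ∑ (upTo (2 + N)) G
          ≈⟨ ∑-upTo-shift (suc N) G (∑-upTo-zero (2 + N) _ (λ k → ≈-refl)) ⟩
        ∑ (upTo (1 + N)) (λ j → G (suc j))
          ≈⟨ trim 1 _ (λ j N≤j → ∑-upTo-zero (2 + N) _ (λ k → ·-zero _ (*≡0ʳ k (γ-beyondⱼ n₁ i j k N≤j)))) ⟩
        ∑ (upTo N) (λ j → G (suc j))
          ≈⟨ ∑-cong (upTo N) (λ j → ≈-trans (trim 2 _ (λ k N≤k → ·-zero _ (*≡0ʳ k (γ-beyondₖ n₁ i j k N≤k))))
                                            (∑-cong (upTo N) (λ k → *-· k (γ n₁ i j k) (X i (suc j) k)))) ⟩
        ∑ (upTo N) (λ j → ∑ (upTo N) (λ k → Q₃ i j k)) ∎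
        where
        G : ℕ → Carrier
        G j = ∑ (upTo (2 + N)) (λ k → γ₃ m i j k · X i j k)

    box-γ₂ : box (2 + N) (λ i j k → γ₂ m i j k · X i j k) ≈ box N Q₂
    box-γ₂ = begin
      ∑ (upTo (2 + N)) F                 ≈⟨ ∑-upTo-shift (suc N) F (∑-upTo-zero (2 + N) _ (λ j → ∑-upTo-zero (2 + N) _ (λ k → ≈-refl))) ⟩
      ∑ (upTo (1 + N)) (λ i → F (suc i)) ≈⟨ trim 1 _ beyond ⟩
      ∑ (upTo N) (λ i → F (suc i))       ≈⟨ ∑-cong (upTo N) shifted ⟩
      box N Q₂                           ∎
      where
      F : ℕ → Carrier
      F i = ∑ (upTo (2 + N)) (λ j → ∑ (upTo (2 + N)) (λ k → γ₂ m i j k · X i j k))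
      beyond : ∀ i → N ≤ i → F (suc i) ≈ 0#
      beyond i N≤i = ∑-upTo-zero (2 + N) _ (λ j → ∑-upTo-zero (2 + N) _ (vanishes j))
        where
        vanishes : ∀ j k → γ₂ m (suc i) j k · X (suc i) j k ≈ 0#
        vanishes j zero    = ≈-refl
        vanishes j (suc k) = ·-zero _ (*≡0ʳ (2 * suc j) (γ-beyondᵢ n₁ i (suc j) k N≤i))
      H : ℕ → ℕ → Carrier
      H i j = ∑ (upTo N) (λ k → Q₂ i j k)
      shifted : ∀ i → F (suc i) ≈ ∑ (upTo N) (H i)
      shifted i = begin
        F (suc i)
          ≈⟨ ∑-cong (upTo (2 + N)) (λ j → begin
               ∑ (upTo (2 + N)) (λ k → γ₂ m (suc i) j k · X (suc i) j k)
                 ≈⟨ ∑-upTo-shift (suc N) _ ≈-refl ⟩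
               ∑ (upTo (1 + N)) (λ k → γ₂ m (suc i) j (suc k) · X (suc i) j (suc k))
                 ≈⟨ trim 1 _ (λ k N≤k → ·-zero _ (*≡0ʳ (2 * suc j) (γ-beyondₖ n₁ i (suc j) k N≤k))) ⟩
               ∑ (upTo N) (λ k → γ₂ m (suc i) j (suc k) · X (suc i) j (suc k))
                 ≈⟨ ∑-cong (upTo N) (λ k → *-· (2 * suc j) (γ n₁ i (suc j) k) (X (suc i) j (suc k))) ⟩
               H i (suc j) ∎) ⟩
        ∑ (upTo (2 + N)) (λ j → H i (suc j))
          ≈⟨ ∑-upTo-shift (2 + N) (H i) (∑-upTo-zero N _ (λ k → ×-zeroʳ (γ n₁ i 0 k))) ⟨
        ∑ (upTo (3 + N)) (H i)
          ≈⟨ trim 3 _ (λ j N≤j → ∑-upTo-zero N _ (λ k → ·-zero _ (γ-beyondⱼ n₁ i j k N≤j))) ⟩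
        ∑ (upTo N) (H i) ∎

    box-γ₁ : box (2 + N) (λ i j k → γ₁ m i j k · X i j k) ≈ box N Q₁
    box-γ₁ = begin
      ∑ (upTo (2 + N)) F
        ≈⟨ ∑-cong (upTo (2 + N)) shifted ⟩
      ∑ (upTo (2 + N)) (λ i → E (suc i))
        ≈⟨ ∑-upTo-shift (2 + N) E (∑-upTo-zero N _ (λ j → ∑-upTo-zero N _ (λ k → ×-zeroʳ (γ n₁ 0 j k)))) ⟨
      ∑ (upTo (3 + N)) E
        ≈⟨ trim 3 _ (λ i N≤i → ∑-upTo-zero N _ (λ j → ∑-upTo-zero N _ (λ k → ·-zero _ (γ-beyondᵢ n₁ i j k N≤i)))) ⟩
      box N Q₁ ∎
      where
      F : ℕ → Carrier
      F i = ∑ (upTo (2 + N)) (λ j → ∑ (upTo (2 + N)) (λ k → γ₁ m i j k · X i j k))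
      E : ℕ → Carrier
      E i = ∑ (upTo N) (λ j → ∑ (upTo N) (λ k → Q₁ i j k))
      shifted : ∀ i → F i ≈ E (suc i)
      shifted i = begin
        F i
          ≈⟨ ∑-cong (upTo (2 + N)) (λ j → begin
               ∑ (upTo (2 + N)) (λ k → γ₁ m i j k · X i j k)
                 ≈⟨ ∑-upTo-shift (suc N) _ ≈-refl ⟩
               ∑ (upTo (1 + N)) (λ k → γ₁ m i j (suc k) · X i j (suc k))
                 ≈⟨ trim 1 _ (λ k N≤k → ·-zero _ (*≡0ʳ (3 * suc i) (γ-beyondₖ n₁ (suc i) j k N≤k))) ⟩
               ∑ (upTo N) (λ k → γ₁ m i j (suc k) · X i j (suc k))
                 ≈⟨ ∑-cong (upTo N) (λ k → *-· (3 * suc i) (γ n₁ (suc i) j k) (X i j (suc k))) ⟩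
               ∑ (upTo N) (λ k → Q₁ (suc i) j k) ∎) ⟩
        ∑ (upTo (2 + N)) (λ j → ∑ (upTo N) (λ k → Q₁ (suc i) j k))
          ≈⟨ trim 2 _ (λ j N≤j → ∑-upTo-zero N _ (λ k → ·-zero _ (γ-beyondⱼ n₁ (suc i) j k N≤j))) ⟩
        E (suc i) ∎

  γSum-suc : ∀ m X → γSum (suc (suc m)) X ≈ γSum (suc m) (adjoint X)
  γSum-suc m X = begin
    γSum (suc n₁) X
      ≡⟨ cong (λ M → box M (λ i j k → γ (suc n₁) i j k · X i j k)) (bound-suc n₁) ⟩
    box (2 + N) (λ i j k → γ (suc n₁) i j k · X i j k)
      ≈⟨ box-cong (2 + N) split ⟩
    box (2 + N) (λ i j k → γ₁ m i j k · X i j k ⊕ (γ₂ m i j k · X i j k ⊕ γ₃ m i j k · X i j k))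
      ≈⟨ ≈-trans (box-⊕ (2 + N) _ _) (+-congˡ (box-⊕ (2 + N) _ _)) ⟩
    box (2 + N) (λ i j k → γ₁ m i j k · X i j k) ⊕
      (box (2 + N) (λ i j k → γ₂ m i j k · X i j k) ⊕ box (2 + N) (λ i j k → γ₃ m i j k · X i j k))
      ≈⟨ +-cong box-γ₁ (+-cong box-γ₂ box-γ₃) ⟩
    box N Q₁ ⊕ (box N Q₂ ⊕ box N Q₃)
      ≈⟨ ≈-trans (box-⊕ N _ _) (+-congˡ (box-⊕ N _ _)) ⟨
    box N (λ i j k → Q₁ i j k ⊕ (Q₂ i j k ⊕ Q₃ i j k))
      ≈⟨ box-cong N collect ⟩
    γSum n₁ (adjoint X) ∎
    where
    open RecurrenceStep m X
    split : ∀ i j k → γ (suc n₁) i j k · X i j k ≈ γ₁ m i j k · X i j k ⊕ (γ₂ m i j k · X i j k ⊕ γ₃ m i j k · X i j k)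
    split i j k = ≈-trans (≈-reflexive (cong (_· X i j k) (γ-unfold m i j k)))
      (≈-trans (×-homo-+ (X i j k) (γ₁ m i j k + γ₂ m i j k) (γ₃ m i j k))
      (≈-trans (+-congʳ (×-homo-+ (X i j k) (γ₁ m i j k) (γ₂ m i j k))) (+-assoc _ _ _)))
    collect : ∀ i j k → Q₁ i j k ⊕ (Q₂ i j k ⊕ Q₃ i j k) ≈ γ n₁ i j k · adjoint X i j k
    collect i j k = ≈-trans (x∙yz≈z∙yx (Q₁ i j k) (Q₂ i j k) (Q₃ i j k))
      (≈-sym (≈-trans (×-distrib-+ _ _ (γ n₁ i j k)) (+-congˡ (×-distrib-+ _ _ (γ n₁ i j k)))))

  γSum-one : ∀ X → γSum 1 X ≈ X 0 0 1
  γSum-one X = ≈-trans (∑-upTo-single 4 0 _ z<s i≢0)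
               (≈-trans (∑-upTo-single 4 0 _ z<s j≢0)
               (≈-trans (∑-upTo-single 4 1 _ (s≤s z<s) k≢1) (+-identityʳ _)))
    where
    i≢0 : ∀ i → i ≢ 0 → ∑ (upTo 4) (λ j → ∑ (upTo 4) (λ k → γ 1 i j k · X i j k)) ≈ 0#
    i≢0 zero    0≢0 = ⊥-elim (0≢0 refl)
    i≢0 (suc i) _   = ∑-upTo-zero 4 _ (λ j → ∑-upTo-zero 4 _ (λ k → ≈-refl))
    j≢0 : ∀ j → j ≢ 0 → ∑ (upTo 4) (λ k → γ 1 0 j k · X 0 j k) ≈ 0#
    j≢0 zero    0≢0 = ⊥-elim (0≢0 refl)
    j≢0 (suc j) _   = ∑-upTo-zero 4 _ (λ k → ≈-refl)
    k≢1 : ∀ k → k ≢ 1 → γ 1 0 0 k · X 0 0 k ≈ 0#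
    k≢1 zero          _   = ≈-refl
    k≢1 (suc zero)    1≢1 = ⊥-elim (1≢1 refl)
    k≢1 (suc (suc k)) _   = ≈-refl

  countSum≈γSum : ∀ k X → countSum k X ≈ γSum (suc k) X
  countSum≈γSum zero    X = ≈-trans (≈-trans (+-identityʳ _) (+-identityʳ _)) (≈-sym (γSum-one X))
  countSum≈γSum (suc k) X =
    ≈-trans (countSum-suc k X) (≈-trans (countSum≈γSum k (adjoint X)) (≈-sym (γSum-suc k X)))

  RHS≈γSum : ∀ n β₁ β₄ β₅ → Eval.RHS R n β₁ β₄ β₅ ≈ γSum n (λ i j _ → (β₁ ⊕ β₄ ⊕ β₅) ^ (i + j))
  RHS≈γSum n β₁ β₄ β₅ = box-cong (bound n) λ i j k → drop-if (i + 2 * j + 3 * k ≟ suc (n + n)) (γ-off-support n i j k)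
    where
    drop-if : ∀ {P : Set} (P? : Dec P) {g x} → (¬ P → g ≡ 0) → (if does P? then g · x else 0#) ≈ g · x
    drop-if (yes _) _   = ≈-refl
    drop-if (no ¬p) g≡0 = ≈-sym (·-zero _ (g≡0 ¬p))

corollary2 : ∀ {c ℓ : Level} (R : CommutativeSemiring c ℓ) (n : ℕ) → 1 ≤ n →
    (Q : List (List ℕ)) → Unique Q → (∀ σ → (σ ∈ Q) ⇔ IsStirling n σ) →
    (β₁ β₄ β₅ : CommutativeSemiring.Carrier R) →
    CommutativeSemiring._≈_ R (Eval.M R n Q β₁ β₄ β₅) (Eval.RHS R n β₁ β₄ β₅)
corollary2 R (suc k) _ Q unique enumerates β₁ β₄ β₅ = begin
  ∑ Q (monomial (suc k))                     ≈⟨ ∑-enumeration (suc k) Q unique enumerates (monomial (suc k)) ⟩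
  ∑ (stirlings (suc k)) (monomial (suc k))   ≈⟨ ∑-cong∈ (stirlings (suc k)) (λ _ σ∈ → monomial≈Π-weight (suc k) σ∈) ⟩
  stirlingSum k (λ _ → weight)               ≈⟨ stirlingSum≈historySum k (λ _ → weight) ⟩
  historySum k (λ _ → weight)                ≈⟨ historySum-weight k ⟩
  countSum k (λ i j _ → e ^ (i + j))         ≈⟨ countSum≈γSum k _ ⟩
  γSum (suc k) (λ i j _ → e ^ (i + j))       ≈⟨ RHS≈γSum (suc k) β₁ β₄ β₅ ⟨
  Eval.RHS R (suc k) β₁ β₄ β₅                ∎
  where
  open Sums R
  open Weights R β₁ β₄ β₅
  open Expansion R
  open Counting R
  open Uniform R β₁ β₄ β₅
  open CoefficientSums R
  open import Relation.Binary.Reasoning.Setoid (CommutativeSemiring.setoid R)
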